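{- Let $r\ge 3$ and let $C_r$ be the cycle with vertex set $V_{C_r}$. Let $\mathcal F$ be a finite family of pairwise disjoint trees (disjoint from $C_r$), each $T\in\mathcal F$ with a distinguished vertex $y_T\in V_T$, and let $T\mapsto x_T$ be a map $\mathcal F\to V_{C_r}$. Let $G=(V,E)$ be the (unicyclic) graph obtained from the disjoint union of $C_r$ and all $T\in\mathcal F$ by identifying $y_T$ with $x_T$ for every $T\in\mathcal F$. For $x\in V_{C_r}$ let $\mathcal F_x=\{T\in\mathcal F:x_T=x\}$ and $n_x=\sum_{T\in\mathcal F_x}|V_T|-|\mathcal F_x|+1$; let $\mathbf n$ be the vector indexed by $V_{C_r}$ with components $n_x$, and let $\mathbf D$ be the distance matrix of $C_r$. Then the degree distance of $G$ is $$ M_{G}^{\delta}=\sum_{T\in\mathcal F}M_{T}^{\delta_T}+\sum_{T\in\mathcal F}M_{T}^{\eta_T}(y_T)+2\,\mathbf n^{\top}\mathbf D\,\mathbf n, $$ where $\delta$ is the degree function of $G$, $\delta_T$ is the degree function of $T$, and $\eta_T$ is the function on $V_T$ given by $\eta_T(v)=(|V|-|V_T|)(\delta_T(v)+2)+2$.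
   Context: For a connected graph $G$ with vertex set $V$, distance function $\operatorname{dist}$, and a function $\rho:V\to\mathbb{R}$, the $\rho$-moment of $G$ at $u$ is $M_G^{\rho}(u)=\sum_{v\in V}\rho(v)\operatorname{dist}(v,u)$ and the $\rho$-moment of $G$ is $M_G^{\rho}=\sum_{u\in V}M_G^{\rho}(u)$. With $\rho=\delta$ the degree function, $M_G^{\delta}$ is the degree distance of $G$. Moments $M_T^{\cdot}$ are computed in the tree $T$. -}

module Defs where

open import Data.Nat using (ℕ; zero; suc; _+_; _*_; _∸_; _≤_; _≡ᵇ_)
open import Data.Bool using (Bool; true; false; _∨_; _∧_; if_then_else_)
open import Data.Fin using (Fin; toℕ; punchIn; inject₁; fromℕ) renaming (zero to fzero; suc to fsuc)
import Data.Fin as Fin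
open import Data.List using (List; map; length; upTo; allFin; _++_; concatMap)
open import Data.Nat.ListAction using (sum)
open import Data.Bool.ListAction using (any)
open import Data.Sum using (_⊎_; inj₁; inj₂)
open import Data.Product using (Σ; _,_; ∃; _×_)
import Data.Sum.Properties as SumP
import Data.Product.Properties as ProdP
open import Relation.Nullary using (¬_; yes; no)
open import Relation.Nullary.Decidable using (isYes)
open import Relation.Binary.Definitions using (DecidableEquality)
open import Relation.Binary.PropositionalEquality using (_≡_; refl)
open import Function.Definitions using (Injective)

record FinGraph : Set₁ where
  field
    V     : Set
    verts : List V
    _≟_   : DecidableEquality V
    adj   : V → V → Bool

module _ (G : FinGraph) where
  open FinGraph G

  ΣV : (V → ℕ) → ℕ
  ΣV f = sum (map f verts)

  order : ℕ
  order = length verts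

  deg : V → ℕ
  deg v = ΣV (λ w → if adj v w then 1 else 0)

  reach : ℕ → V → V → Bool
  reach zero    u v = isYes (u ≟ v)
  reach (suc k) u v = reach k u v ∨ any (λ w → adj u w ∧ reach k w v) verts

  -- graph distance: the least k with reach k u v (for connected graphs
  -- this is the usual shortest-path distance, always < order)
  dist : V → V → ℕ
  dist u v = sum (map (λ k → if reach k u v then 0 else 1) (upTo order))

  momentAt : (V → ℕ) → V → ℕ
  momentAt ρ u = ΣV (λ v → ρ v * dist v u)

  moment : (V → ℕ) → ℕ
  moment ρ = ΣV (λ u → momentAt ρ u)

  degreeDistance : ℕ
  degreeDistance = moment deg

finGraph : (s : ℕ) → (Fin s → Fin s → Bool) → FinGraph
finGraph s a = record { V = Fin s ; verts = allFin s ; _≟_ = Fin._≟_ ; adj = a }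

HasCycle : {s : ℕ} → (Fin s → Fin s → Bool) → Set
HasCycle {s} a =
  Σ ℕ λ k → Σ (Fin (suc (suc (suc k))) → Fin s) λ c →
    Injective _≡_ _≡_ c
    × (∀ (i : Fin (suc (suc k))) → a (c (inject₁ i)) (c (fsuc i)) ≡ true)
    × (a (c (fromℕ (suc (suc k)))) (c fzero) ≡ true)

record IsTree (s : ℕ) (a : Fin s → Fin s → Bool) : Set where
  field
    symmetric   : ∀ u v → a u v ≡ a v u
    irreflexive : ∀ u → a u u ≡ false
    connected   : ∀ u v → Σ ℕ λ k → reach (finGraph s a) k u v ≡ true
    acyclic     : ¬ HasCycle a

cycAdj : (r : ℕ) → Fin r → Fin r → Bool
cycAdj r a b =
  (toℕ b ≡ᵇ suc (toℕ a)) ∨ (toℕ a ≡ᵇ suc (toℕ b))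
  ∨ ((toℕ a ≡ᵇ 0) ∧ (suc (toℕ b) ≡ᵇ r))
  ∨ ((toℕ b ≡ᵇ 0) ∧ (suc (toℕ a) ≡ᵇ r))

cycle : ℕ → FinGraph
cycle r = finGraph r (cycAdj r)

record Family (r : ℕ) : Set where
  field
    m    : ℕ
    t    : Fin m → ℕ
    tadj : (i : Fin m) → Fin (suc (t i)) → Fin (suc (t i)) → Bool
    y    : (i : Fin m) → Fin (suc (t i))
    x    : Fin m → Fin r

module _ {r : ℕ} (F : Family r) where
  open Family F

  tree : Fin m → FinGraph
  tree i = finGraph (suc (t i)) (tadj i)

  -- Vertices of the glued graph G: cycle vertices, plus the vertices of
  -- each T_i other than y_i (the latter is identified with x_i).
  -- The non-distinguished vertices of T_i are punchIn (y i) j, j : Fin (t i).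
  VG : Set
  VG = Fin r ⊎ Σ (Fin m) (λ i → Fin (t i))

  vertsG : List VG
  vertsG = map inj₁ (allFin r) ++ concatMap (λ i → map (λ j → inj₂ (i , j)) (allFin (t i))) (allFin m)


  adjG : VG → VG → Bool
  adjG (inj₁ a) (inj₁ b) = cycAdj r a b
  adjG (inj₁ a) (inj₂ (i , v)) = isYes (x i Fin.≟ a) ∧ tadj i (y i) (punchIn (y i) v)
  adjG (inj₂ (i , u)) (inj₁ b) = isYes (x i Fin.≟ b) ∧ tadj i (punchIn (y i) u) (y i)
  adjG (inj₂ (i , u)) (inj₂ (j , v)) with i Fin.≟ j
  ... | yes refl = tadj i (punchIn (y i) u) (punchIn (y i) v)
  ... | no _     = false

  glued : FinGraph
  glued = record
    { V = VG
    ; verts = vertsG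
    ; _≟_ = SumP.≡-dec Fin._≟_ (ProdP.≡-dec Fin._≟_ Fin._≟_)
    ; adj = adjG
    }

  ordG : ℕ
  ordG = order glued

  nVec : Fin r → ℕ
  nVec z = (sum (map (λ i → if isYes (x i Fin.≟ z) then order (tree i) else 0) (allFin m))
            ∸ sum (map (λ i → if isYes (x i Fin.≟ z) then 1 else 0) (allFin m))) + 1

  nDn : ℕ
  nDn = sum (map (λ a → sum (map (λ b → nVec a * dist (cycle r) a b * nVec b) (allFin r))) (allFin r))

  η : (i : Fin m) → Fin (suc (t i)) → ℕ
  η i v = (ordG ∸ order (tree i)) * (deg (tree i) v + 2) + 2

  rhs : ℕ
  rhs = sum (map (λ i → degreeDistance (tree i)) (allFin m))
      + sum (map (λ i → momentAt (tree i) (η i) (y i)) (allFin m))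
      + 2 * nDn

module Submission where

-- We compute the distance of G explicitly
-- and sum.
-- 1. For a finite graph, dist is characterised by the axioms IsWalkDistance:
--    zero exactly on the diagonal, dropping by at most one along an edge, and
--    decreasable by one along some edge (with a pigeonhole bound on walks).
-- 2. In a tree rooted at y, adjacent vertices lie on neighbouring levels and
--    each non-root vertex has one lower neighbour (else climbing to the first
--    common ancestor closes a cycle); hence Σ deg = 2 t.  C_r is 2-regular.
-- 3. dist G = dG, which climbs from a tree to the cycle, runs along C_r and
--    descends, or stays inside one tree, since dG satisfies the axioms.
-- 4. Summing  dG v u + detour v u = lift v + d_C(foot v, foot u) + lift u +
--    treeDist v u  with weight deg v, both M^δ_G and the right-hand side, each
--    plus the same correction Σ deg v · detour v u, equal
--    N ΣA + 2 nᵀDn + 2N ΣH + ΣP; cancelling the correction gives the theorem.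

open import Defs
open import Data.Nat using (ℕ; zero; suc; _+_; _*_; _∸_; _≤_; _<_; z≤n; s≤s; s≤s⁻¹; _≤?_; _≡ᵇ_; pred) renaming (_≟_ to _≟ℕ_)
open import Data.Nat.Properties hiding (_≟_)
open import Data.Bool using (Bool; true; false; _∨_; _∧_; not; if_then_else_) renaming (_≟_ to _≟𝔹_)
open import Data.Bool.Properties using (∨-zeroʳ; ∨-assoc; ∨-idem; T-≡)
open import Data.Fin using (Fin; toℕ; punchIn; punchOut; inject₁; fromℕ; fromℕ<) renaming (zero to fzero; suc to fsuc)
import Data.Fin as Fin
import Data.Fin.Properties as FinP
open import Data.List using (List; []; _∷_; map; length; allFin; _++_; concatMap; applyUpTo)
import Data.List.Properties as ListP
open import Data.Nat.ListAction using (sum)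
open import Data.Bool.ListAction using (any)
open import Data.List.Membership.Propositional using (_∈_; lose)
import Data.List.Membership.Propositional.Properties as MemP
open import Data.List.Relation.Unary.Any using (here; there; any?; satisfied)
open import Data.Sum using (_⊎_; inj₁; inj₂)
open import Data.Product using (Σ; _,_; _×_; proj₁; proj₂)
open import Data.Empty using (⊥-elim)
open import Relation.Nullary using (¬_; yes; no; Dec; _×-dec_)
open import Relation.Nullary.Decidable using (isYes)
open import Relation.Binary.PropositionalEquality using (_≡_; _≢_; refl; sym; trans; cong; cong₂; subst; module ≡-Reasoning)
open import Function using (_∘_)
open import Function.Bundles using (Equivalence)
open import Data.Nat.Tactic.RingSolver using (solve-∀)

sumL : {A : Set} → (A → ℕ) → List A → ℕ
sumL f xs = sum (map f xs)

module _ {A : Set} where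

  sumL-cong : ∀ xs {f g : A → ℕ} → (∀ a → f a ≡ g a) → sumL f xs ≡ sumL g xs
  sumL-cong []       f≗g = refl
  sumL-cong (a ∷ xs) f≗g = cong₂ _+_ (f≗g a) (sumL-cong xs f≗g)

  sumL-+ : ∀ xs (f g : A → ℕ) → sumL (λ a → f a + g a) xs ≡ sumL f xs + sumL g xs
  sumL-+ []       f g = refl
  sumL-+ (a ∷ xs) f g = trans (cong (f a + g a +_) (sumL-+ xs f g)) (+-interchange (f a) (g a) _ _)
    where
    +-interchange : ∀ p q s u → p + q + (s + u) ≡ p + s + (q + u)
    +-interchange = solve-∀

  sumL-*ˡ : ∀ xs c (f : A → ℕ) → sumL (λ a → c * f a) xs ≡ c * sumL f xs
  sumL-*ˡ []       c f = sym (*-zeroʳ c)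
  sumL-*ˡ (a ∷ xs) c f = trans (cong (c * f a +_) (sumL-*ˡ xs c f)) (sym (*-distribˡ-+ c (f a) _))

  sumL-*ʳ : ∀ xs c (f : A → ℕ) → sumL (λ a → f a * c) xs ≡ sumL f xs * c
  sumL-*ʳ xs c f = trans (sumL-cong xs (λ a → *-comm (f a) c)) (trans (sumL-*ˡ xs c f) (*-comm c _))

  sumL-const : ∀ xs c → sumL {A} (λ _ → c) xs ≡ length xs * c
  sumL-const []       c = refl
  sumL-const (a ∷ xs) c = cong (c +_) (sumL-const xs c)

  sumL-zero : ∀ xs → sumL {A} (λ _ → 0) xs ≡ 0
  sumL-zero xs = trans (sumL-const xs 0) (*-zeroʳ (length xs))

  sumL-vanish : ∀ xs {f : A → ℕ} → (∀ a → f a ≡ 0) → sumL f xs ≡ 0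
  sumL-vanish xs f≡0 = trans (sumL-cong xs f≡0) (sumL-zero xs)

  sumL-++ : ∀ xs ys (f : A → ℕ) → sumL f (xs ++ ys) ≡ sumL f xs + sumL f ys
  sumL-++ []       ys f = refl
  sumL-++ (a ∷ xs) ys f = trans (cong (f a +_) (sumL-++ xs ys f)) (sym (+-assoc (f a) _ _))

  term≤sumL : ∀ {xs w} (f : A → ℕ) → w ∈ xs → f w ≤ sumL f xs
  term≤sumL {a ∷ xs} f (here refl) = m≤m+n (f a) _
  term≤sumL {a ∷ xs} f (there w∈) = ≤-trans (term≤sumL f w∈) (m≤n+m _ (f a))

  sumL-mono : ∀ xs {f g : A → ℕ} → (∀ a → f a ≤ g a) → sumL f xs ≤ sumL g xs
  sumL-mono []       f≤g = ≤-refl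
  sumL-mono (a ∷ xs) f≤g = +-mono-≤ (f≤g a) (sumL-mono xs f≤g)

  sumL-mono-< : ∀ xs {f g : A → ℕ} → (∀ a → f a ≤ g a) → ∀ {w} → w ∈ xs → f w < g w → sumL f xs < sumL g xs
  sumL-mono-< (a ∷ xs) f≤g (here refl) lt = +-mono-<-≤ lt (sumL-mono xs f≤g)
  sumL-mono-< (a ∷ xs) f≤g (there w∈) lt = +-mono-≤-< (f≤g a) (sumL-mono-< xs f≤g w∈ lt)

module _ {A B : Set} where

  sumL-swap : ∀ (xs : List A) (ys : List B) (f : A → B → ℕ) →
              sumL (λ a → sumL (f a) ys) xs ≡ sumL (λ b → sumL (λ a → f a b) xs) ys
  sumL-swap []       ys f = sym (sumL-zero ys)
  sumL-swap (a ∷ xs) ys f = trans (cong (sumL (f a) ys +_) (sumL-swap xs ys f))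
                                  (sym (sumL-+ ys (f a) (λ b → sumL (λ a → f a b) xs)))

  sumL-map : ∀ (g : A → B) (f : B → ℕ) xs → sumL f (map g xs) ≡ sumL (f ∘ g) xs
  sumL-map g f xs = cong sum (sym (ListP.map-∘ xs))

  sumL-concatMap : ∀ (f : B → ℕ) (g : A → List B) xs → sumL f (concatMap g xs) ≡ sumL (λ a → sumL f (g a)) xs
  sumL-concatMap f g []       = refl
  sumL-concatMap f g (a ∷ xs) = trans (sumL-++ (g a) (concatMap g xs) f) (cong (sumL f (g a) +_) (sumL-concatMap f g xs))

sumFin : ∀ n → (Fin n → ℕ) → ℕ
sumFin n f = sumL f (allFin n)

sumFin-cong : ∀ n {f g : Fin n → ℕ} → (∀ i → f i ≡ g i) → sumFin n f ≡ sumFin n g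
sumFin-cong n = sumL-cong (allFin n)

sumFin-const : ∀ n c → sumFin n (λ _ → c) ≡ n * c
sumFin-const n c = trans (sumL-const (allFin n) c) (cong (_* c) (ListP.length-tabulate {n = n} (λ i → i)))

sumFin-suc : ∀ n (f : Fin (suc n) → ℕ) → sumFin (suc n) f ≡ f fzero + sumFin n (f ∘ fsuc)
sumFin-suc n f = cong (f fzero +_) (trans (cong (sumL f) (sym (ListP.map-tabulate (λ i → i) fsuc))) (sumL-map fsuc f (allFin n)))

sumFin-punchIn : ∀ n (c : Fin (suc n)) (f : Fin (suc n) → ℕ) → sumFin (suc n) f ≡ f c + sumFin n (f ∘ punchIn c)
sumFin-punchIn n       fzero    f = sumFin-suc n f
sumFin-punchIn (suc n) (fsuc c) f = begin
    sumFin (suc (suc n)) f                     ≡⟨ sumFin-suc (suc n) f ⟩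
    f fzero + sumFin (suc n) (f ∘ fsuc)        ≡⟨ cong (f fzero +_) (sumFin-punchIn n c (f ∘ fsuc)) ⟩
    f fzero + (f (fsuc c) + rest)             ≡⟨ swap (f fzero) (f (fsuc c)) rest ⟩
    f (fsuc c) + (f fzero + rest)             ≡⟨ cong (f (fsuc c) +_) (sym (sumFin-suc n (f ∘ punchIn (fsuc c)))) ⟩
    f (fsuc c) + sumFin (suc n) (f ∘ punchIn (fsuc c)) ∎
  where
  open ≡-Reasoning
  rest : ℕ
  rest = sumFin n (f ∘ fsuc ∘ punchIn c)
  swap : ∀ p q s → p + (q + s) ≡ q + (p + s)
  swap = solve-∀

sumFin-single : ∀ n (c : Fin n) (f : Fin n → ℕ) → (∀ i → i ≢ c → f i ≡ 0) → sumFin n f ≡ f c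
sumFin-single (suc n) c f vanish = begin
    sumFin (suc n) f                   ≡⟨ sumFin-punchIn n c f ⟩
    f c + sumFin n (f ∘ punchIn c)     ≡⟨ cong (f c +_) (sumL-vanish (allFin n) (λ j → vanish (punchIn c j) (FinP.punchInᵢ≢i c j))) ⟩
    f c + 0                            ≡⟨ +-identityʳ (f c) ⟩
    f c ∎
  where open ≡-Reasoning

∨-introˡ : ∀ {a} b → a ≡ true → a ∨ b ≡ true
∨-introˡ b refl = refl

∨-introʳ : ∀ a {b} → b ≡ true → a ∨ b ≡ true
∨-introʳ a refl = ∨-zeroʳ a

∨-cases : ∀ a b → a ∨ b ≡ true → a ≡ true ⊎ b ≡ true
∨-cases true  b _  = inj₁ refl
∨-cases false b eq = inj₂ eq

∧-split : ∀ a b → a ∧ b ≡ true → a ≡ true × b ≡ true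
∧-split true true _ = refl , refl

isYes-intro : ∀ {P : Set} (d : Dec P) → P → isYes d ≡ true
isYes-intro (yes _) _ = refl
isYes-intro (no ¬p) p = ⊥-elim (¬p p)

isYes-elim : ∀ {P : Set} (d : Dec P) → isYes d ≡ true → P
isYes-elim (yes p) _ = p

isYes-no : ∀ {P : Set} (d : Dec P) → ¬ P → isYes d ≡ false
isYes-no (yes p) ¬p = ⊥-elim (¬p p)
isYes-no (no _)  _  = refl

[_] : Bool → ℕ
[ b ] = if b then 1 else 0

[yes] : ∀ {P : Set} (d : Dec P) → P → [ isYes d ] ≡ 1
[yes] d p = cong [_] (isYes-intro d p)

[no] : ∀ {P : Set} (d : Dec P) → ¬ P → [ isYes d ] ≡ 0
[no] d ¬p = cong [_] (isYes-no d ¬p)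

[isYes]-cong : ∀ {P Q : Set} (p? : Dec P) (q? : Dec Q) → (P → Q) → (Q → P) → [ isYes p? ] ≡ [ isYes q? ]
[isYes]-cong (yes _) (yes _) _   _   = refl
[isYes]-cong (no _)  (no _)  _   _   = refl
[isYes]-cong (yes p) (no ¬q) p⇒q _   = ⊥-elim (¬q (p⇒q p))
[isYes]-cong (no ¬p) (yes q) _   q⇒p = ⊥-elim (¬p (q⇒p q))

[≤] : ∀ a b → (a ≡ true → b ≡ true) → [ a ] ≤ [ b ]
[≤] false b _   = z≤n
[≤] true  b a⇒b rewrite a⇒b refl = ≤-refl

[≤1] : ∀ b → [ b ] ≤ 1
[≤1] true  = ≤-refl
[≤1] false = z≤n

[∧] : ∀ a b → [ a ∧ b ] ≡ [ a ] * [ b ]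
[∧] true  b = sym (*-identityˡ [ b ])
[∧] false b = refl

if-then-0 : ∀ b X → (if b then X else 0) ≡ [ b ] * X
if-then-0 true  X = sym (+-identityʳ X)
if-then-0 false X = refl

δ : ∀ {n} → Fin n → Fin n → ℕ
δ a b = [ isYes (a Fin.≟ b) ]

δ-self : ∀ {n} (a : Fin n) → δ a a ≡ 1
δ-self a = [yes] (a Fin.≟ a) refl

δ-off : ∀ {n} {a b : Fin n} → a ≢ b → δ a b ≡ 0
δ-off {a = a} {b} = [no] (a Fin.≟ b)

δ-sym : ∀ {n} (a b : Fin n) → δ a b ≡ δ b a
δ-sym a b = [isYes]-cong (a Fin.≟ b) (b Fin.≟ a) sym sym

sumFin-δ : ∀ n (c : Fin n) (g : Fin n → ℕ) → sumFin n (λ a → δ c a * g a) ≡ g c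
sumFin-δ n c g = trans (sumFin-single n c _ (λ i i≢c → cong (_* g i) (δ-off (i≢c ∘ sym))))
                       (trans (cong (_* g c) (δ-self c)) (*-identityˡ (g c)))

sumFin-δ′ : ∀ n (c : Fin n) (g : Fin n → ℕ) → sumFin n (λ a → δ a c * g a) ≡ g c
sumFin-δ′ n c g = trans (sumFin-cong n (λ a → cong (_* g a) (δ-sym a c))) (sumFin-δ n c g)

module _ {A : Set} where
  any-intro : (p : A → Bool) {xs : List A} {w : A} → w ∈ xs → p w ≡ true → any p xs ≡ true
  any-intro p {a ∷ xs} (here refl) pw = ∨-introˡ (any p xs) pw
  any-intro p {a ∷ xs} (there w∈)  pw = ∨-introʳ (p a) (any-intro p w∈ pw)

  any-elim : (p : A → Bool) (xs : List A) → any p xs ≡ true → Σ A (λ w → p w ≡ true)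
  any-elim p (a ∷ xs) eq with ∨-cases (p a) (any p xs) eq
  ... | inj₁ pa   = a , pa
  ... | inj₂ rest = any-elim p xs rest

  any-cong : (p q : A → Bool) (xs : List A) → (∀ a → p a ≡ q a) → any p xs ≡ any q xs
  any-cong p q []       p≗q = refl
  any-cong p q (a ∷ xs) p≗q = cong₂ _∨_ (p≗q a) (any-cong p q xs p≗q)

-- A monotone Boolean sequence switches from false to true at most once; the
-- number of failures below N is then the first index at which it holds.
Monotone : (ℕ → Bool) → Set
Monotone f = ∀ k → f k ≡ true → f (suc k) ≡ true

monotone-≤ : ∀ f → Monotone f → ∀ {k l} → k ≤ l → f k ≡ true → f l ≡ true
monotone-≤ f mono {k} {l} k≤l fk with m≤n⇒m<n∨m≡n k≤l
... | inj₂ refl      = fk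
... | inj₁ (s≤s k<l) = mono _ (monotone-≤ f mono k<l fk)

-- dist in Defs is  failures |V| (λ k → reach k u v)
failures : ℕ → (ℕ → Bool) → ℕ
failures N f = sum (applyUpTo (λ k → if f k then 0 else 1) N)

failures-spec : ∀ N f → Monotone f → f N ≡ true →
                ∀ k → (f k ≡ true → failures N f ≤ k) × (failures N f ≤ k → f k ≡ true)
failures-spec zero    f mono fN k = (λ _ → z≤n) , (λ _ → monotone-≤ f mono z≤n fN)
failures-spec (suc N) f mono fN k with f 0 in f0
... | true  = (λ _ → ≤-trans (≤-reflexive noFailures) z≤n) , (λ _ → monotone-≤ f mono z≤n f0)
  where
  noFailures : failures N (f ∘ suc) ≡ 0
  noFailures = n≤0⇒n≡0 (proj₁ (failures-spec N (f ∘ suc) (mono ∘ suc) fN 0) (mono 0 f0))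
... | false = forward k , backward k
  where
  shifted : ∀ k → (f (suc k) ≡ true → failures N (f ∘ suc) ≤ k) × (failures N (f ∘ suc) ≤ k → f (suc k) ≡ true)
  shifted = failures-spec N (f ∘ suc) (mono ∘ suc) fN
  forward : ∀ k → f k ≡ true → suc (failures N (f ∘ suc)) ≤ k
  forward zero    fk with () ← trans (sym fk) f0
  forward (suc k) fk = s≤s (proj₁ (shifted k) fk)
  backward : ∀ k → suc (failures N (f ∘ suc)) ≤ k → f k ≡ true
  backward (suc k) (s≤s le) = proj₂ (shifted k) le

module Reachability (G : FinGraph) (complete : ∀ v → v ∈ FinGraph.verts G) where
  open FinGraph G

  R : ℕ → V → V → Bool
  R = reach G

  reach-suc : ∀ k u v → R k u v ≡ true → R (suc k) u v ≡ true
  reach-suc k u v r = ∨-introˡ _ r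

  reach-≤ : ∀ {k l} u v → k ≤ l → R k u v ≡ true → R l u v ≡ true
  reach-≤ u v = monotone-≤ (λ k → R k u v) (λ k → reach-suc k u v)

  reach-zero⇒≡ : ∀ u v → R 0 u v ≡ true → u ≡ v
  reach-zero⇒≡ u v = isYes-elim (u ≟ v)

  reach-refl : ∀ v → R 0 v v ≡ true
  reach-refl v = isYes-intro (v ≟ v) refl

  reach-suc-cases : ∀ k u v → R (suc k) u v ≡ true →
                    R k u v ≡ true ⊎ Σ V (λ w → adj u w ≡ true × R k w v ≡ true)
  reach-suc-cases k u v r with ∨-cases _ _ r
  ... | inj₁ shorter = inj₁ shorter
  ... | inj₂ viaEdge with any-elim (λ w → adj u w ∧ R k w v) verts viaEdge
  ... | w , uwv = inj₂ (w , ∧-split _ _ uwv)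

  reach-step : ∀ k u w v → adj u w ≡ true → R k w v ≡ true → R (suc k) u v ≡ true
  reach-step k u w v uw wv = ∨-introʳ _ (any-intro (λ w → adj u w ∧ R k w v) (complete w) (trans (cong (_∧ R k w v) uw) wv))

  reach-trans : ∀ k l u w v → R k u w ≡ true → R l w v ≡ true → R (k + l) u v ≡ true
  reach-trans zero    l u w v uw wv rewrite reach-zero⇒≡ u w uw = wv
  reach-trans (suc k) l u w v uw wv with reach-suc-cases k u w uw
  ... | inj₁ shorter          = reach-suc (k + l) u v (reach-trans k l u w v shorter wv)
  ... | inj₂ (u' , uu' , u'w) = reach-step (k + l) u u' v uu' (reach-trans k l u' w v u'w wv)

  reach-sym : (∀ u v → adj u v ≡ adj v u) → ∀ k u v → R k u v ≡ true → R k v u ≡ true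
  reach-sym sym-adj zero    u v r rewrite reach-zero⇒≡ u v r = reach-refl v
  reach-sym sym-adj (suc k) u v r with reach-suc-cases k u v r
  ... | inj₁ shorter        = reach-suc k v u (reach-sym sym-adj k u v shorter)
  ... | inj₂ (w , uw , wv) = subst (λ n → R n v u ≡ true) (+-comm k 1)
                                    (reach-trans k 1 v w u (reach-sym sym-adj k w v wv) lastEdge)
    where
    lastEdge : R 1 w u ≡ true
    lastEdge = reach-step 0 w u u (trans (sym-adj w u) uw) (reach-refl u)

  -- The sets S_k = { u | R k u v } grow with k; once S_{k+1} = S_k they are
  -- constant, and since |S_0| ≥ 1 and |S_k| ≤ |V| this happens before |V|.
  module Stabilisation (v : V) where
    S : ℕ → V → Bool
    S k u = R k u v

    size : ℕ → ℕ
    size k = sumL (λ u → [ S k u ]) verts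

    Stable : ℕ → Set
    Stable k = ∀ u → S (suc k) u ≡ S k u

    stable-suc : ∀ k → Stable k → Stable (suc k)
    stable-suc k st u = begin
        S (suc k) u ∨ any (λ w → adj u w ∧ S (suc k) w) verts
          ≡⟨ cong (S (suc k) u ∨_) (any-cong _ _ verts (λ w → cong (adj u w ∧_) (st w))) ⟩
        (S k u ∨ X) ∨ X   ≡⟨ ∨-assoc (S k u) X X ⟩
        S k u ∨ (X ∨ X)   ≡⟨ cong (S k u ∨_) (∨-idem X) ⟩
        S (suc k) u ∎
      where
      open ≡-Reasoning
      X : Bool
      X = any (λ w → adj u w ∧ S k w) verts

    stable-forever : ∀ k → Stable k → ∀ l u → S (l + k) u ≡ S k u
    stable-forever k st zero    u = refl
    stable-forever k st (suc l) u = trans (stable-from l u) (stable-forever k st l u)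
      where
      stable-from : ∀ l → Stable (l + k)
      stable-from zero    = st
      stable-from (suc l) = stable-suc (l + k) (stable-from l)

    NewAt : ℕ → V → Set
    NewAt k u = S k u ≡ false × S (suc k) u ≡ true

    stable-or-new : ∀ k → Stable k ⊎ Σ V (NewAt k)
    stable-or-new k with any? (λ u → (S k u ≟𝔹 false) ×-dec (S (suc k) u ≟𝔹 true)) verts
    ... | yes new  = inj₂ (satisfied new)
    ... | no ¬new = inj₁ (λ u → unchanged u (S k u) (S (suc k) u) refl refl (reach-suc k u v))
      where
      unchanged : ∀ u b c → S k u ≡ b → S (suc k) u ≡ c → (b ≡ true → c ≡ true) → c ≡ b
      unchanged u true  true  _  _  _    = refl
      unchanged u false false _  _  _    = refl
      unchanged u true  false _  _  mono = mono refl
      unchanged u false true  e₁ e₂ _    = ⊥-elim (¬new (lose (complete u) (e₁ , e₂)))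

    size-grows : ∀ k → Σ V (NewAt k) → size k < size (suc k)
    size-grows k (u , old , new) = sumL-mono-< verts (λ w → [≤] _ _ (reach-suc k w v)) (complete u)
      (subst (λ b → [ b ] < [ S (suc k) u ]) (sym old) (subst (λ b → 0 < [ b ]) (sym new) (s≤s z≤n)))

    size-positive : 1 ≤ size 0
    size-positive = ≤-trans (subst (λ b → 1 ≤ [ b ]) (sym (reach-refl v)) ≤-refl)
                            (term≤sumL (λ u → [ S 0 u ]) (complete v))

    size-bounded : ∀ k → size k ≤ length verts
    size-bounded k = ≤-trans (sumL-mono verts (λ u → [≤1] (S k u))) (≤-reflexive (trans (sumL-const verts 1) (*-identityʳ _)))

    stable-or-large : ∀ j → Σ ℕ (λ i → i < j × Stable i) ⊎ suc j ≤ size j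
    stable-or-large zero = inj₂ size-positive
    stable-or-large (suc j) with stable-or-large j
    ... | inj₁ (i , i<j , st) = inj₁ (i , ≤-trans i<j (n≤1+n j) , st)
    ... | inj₂ large with stable-or-new j
    ... | inj₁ st  = inj₁ (j , ≤-refl , st)
    ... | inj₂ new = inj₂ (≤-trans (s≤s large) (size-grows j new))

    stable-below-order : Σ ℕ (λ i → i < length verts × Stable i)
    stable-below-order with stable-or-large (length verts)
    ... | inj₁ found = found
    ... | inj₂ large = ⊥-elim (1+n≰n (≤-trans large (size-bounded (length verts))))

  reach-within-order : ∀ k u v → R k u v ≡ true → R (order G) u v ≡ true
  reach-within-order k u v r with Stabilisation.stable-below-order v
  ... | i , i<N , st with k ≤? i
  ... | yes k≤i = reach-≤ u v (≤-trans k≤i (<⇒≤ i<N)) r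
  ... | no k≰i  = reach-≤ u v (<⇒≤ i<N) (trans (sym (Stabilisation.stable-forever v i st (k ∸ i) u)) r′)
    where
    r′ : R (k ∸ i + i) u v ≡ true
    r′ = subst (λ n → R n u v ≡ true) (sym (m∸n+n≡m (<⇒≤ (≰⇒> k≰i)))) r

  dist-spec : (∀ u v → Σ ℕ (λ k → R k u v ≡ true)) → ∀ u v k →
              (R k u v ≡ true → dist G u v ≤ k) × (dist G u v ≤ k → R k u v ≡ true)
  dist-spec conn u v k rewrite ListP.map-applyUpTo (λ k → k) (λ k → if R k u v then 0 else 1) (order G) =
    failures-spec (order G) (λ k → R k u v) (λ k → reach-suc k u v)
                  (reach-within-order (proj₁ (conn u v)) u v (proj₂ (conn u v))) k

record IsWalkDistance (G : FinGraph) (d : FinGraph.V G → FinGraph.V G → ℕ) : Set where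
  open FinGraph G
  field
    zero⇒≡  : ∀ u v → d u v ≡ 0 → u ≡ v
    diagonal : ∀ v → d v v ≡ 0
    step     : ∀ u w v → adj u w ≡ true → d u v ≤ suc (d w v)
    descend  : ∀ u v n → d u v ≡ suc n → Σ V (λ w → adj u w ≡ true × d w v ≡ n)

module Distance (G : FinGraph) (complete : ∀ v → v ∈ FinGraph.verts G) where
  open FinGraph G
  open Reachability G complete public

  module _ {d : V → V → ℕ} (isD : IsWalkDistance G d) where
    open IsWalkDistance isD

    walkDistance-reach : ∀ k u v → (R k u v ≡ true → d u v ≤ k) × (d u v ≤ k → R k u v ≡ true)
    walkDistance-reach zero u v =
        (λ r → ≤-reflexive (trans (cong (d u) (sym (reach-zero⇒≡ u v r))) (diagonal u)))
      , (λ d≤0 → subst (λ w → R 0 u w ≡ true) (zero⇒≡ u v (n≤0⇒n≡0 d≤0)) (reach-refl u))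
    walkDistance-reach (suc k) u v = bounded , reachable
      where
      bounded : R (suc k) u v ≡ true → d u v ≤ suc k
      bounded r with reach-suc-cases k u v r
      ... | inj₁ shorter       = ≤-trans (proj₁ (walkDistance-reach k u v) shorter) (n≤1+n k)
      ... | inj₂ (w , uw , wv) = ≤-trans (step u w v uw) (s≤s (proj₁ (walkDistance-reach k w v) wv))
      reachable : d u v ≤ suc k → R (suc k) u v ≡ true
      reachable d≤ with m≤n⇒m<n∨m≡n d≤
      ... | inj₁ (s≤s d≤k) = reach-suc k u v (proj₂ (walkDistance-reach k u v) d≤k)
      ... | inj₂ d≡ with descend u v k d≡
      ... | w , uw , dw = reach-step k u w v uw (proj₂ (walkDistance-reach k w v) (≤-reflexive dw))

    dist≡walkDistance : ∀ u v → dist G u v ≡ d u v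
    dist≡walkDistance u v =
      ≤-antisym (proj₁ (spec u v (d u v)) (proj₂ (walkDistance-reach (d u v) u v) ≤-refl))
                (proj₁ (walkDistance-reach (dist G u v) u v) (proj₂ (spec u v (dist G u v)) ≤-refl))
      where
      spec : ∀ u v k → (R k u v ≡ true → dist G u v ≤ k) × (dist G u v ≤ k → R k u v ≡ true)
      spec = dist-spec (λ u v → d u v , proj₂ (walkDistance-reach (d u v) u v) ≤-refl)

  module Connected (conn : ∀ u v → Σ ℕ (λ k → R k u v ≡ true)) where
    private
      spec : ∀ u v k → (R k u v ≡ true → dist G u v ≤ k) × (dist G u v ≤ k → R k u v ≡ true)
      spec = dist-spec conn

    reach-dist : ∀ u v → R (dist G u v) u v ≡ true
    reach-dist u v = proj₂ (spec u v (dist G u v)) ≤-refl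

    dist-minimal : ∀ {k} u v → R k u v ≡ true → dist G u v ≤ k
    dist-minimal {k} u v = proj₁ (spec u v k)

    zero⇒≡ : ∀ u v → dist G u v ≡ 0 → u ≡ v
    zero⇒≡ u v d≡0 = reach-zero⇒≡ u v (subst (λ k → R k u v ≡ true) d≡0 (reach-dist u v))

    diagonal : ∀ v → dist G v v ≡ 0
    diagonal v = n≤0⇒n≡0 (dist-minimal v v (reach-refl v))

    step : ∀ u w v → adj u w ≡ true → dist G u v ≤ suc (dist G w v)
    step u w v uw = dist-minimal u v (reach-step (dist G w v) u w v uw (reach-dist w v))

    descend : ∀ u v n → dist G u v ≡ suc n → Σ V (λ w → adj u w ≡ true × dist G w v ≡ n)
    descend u v n d≡ with reach-suc-cases n u v (subst (λ k → R k u v ≡ true) d≡ (reach-dist u v))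
    ... | inj₁ shorter       = ⊥-elim (1+n≰n (≤-trans (≤-reflexive (sym d≡)) (dist-minimal u v shorter)))
    ... | inj₂ (w , uw , wv) = w , uw , ≤-antisym (dist-minimal w v wv) (s≤s⁻¹ (≤-trans (≤-reflexive (sym d≡)) (step u w v uw)))

    dist-sym : (∀ u v → adj u v ≡ adj v u) → ∀ u v → dist G u v ≡ dist G v u
    dist-sym sym-adj u v = ≤-antisym (dist-minimal u v (reach-sym sym-adj (dist G v u) v u (reach-dist v u)))
                                     (dist-minimal v u (reach-sym sym-adj (dist G u v) u v (reach-dist u v)))

closedWalk⇒cycle : ∀ {s} (a : Fin s → Fin s → Bool) (k : ℕ) (g : ℕ → Fin s) →
  (∀ i j → i < 3 + k → j < 3 + k → g i ≡ g j → i ≡ j) →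
  (∀ i → suc i < 3 + k → a (g i) (g (suc i)) ≡ true) →
  a (g (2 + k)) (g 0) ≡ true → HasCycle a
closedWalk⇒cycle {s} a k g distinct edge closing = k , c , c-injective , c-edge , c-closing
  where
  c : Fin (3 + k) → Fin s
  c i = g (toℕ i)
  c-injective : ∀ {i j} → c i ≡ c j → i ≡ j
  c-injective {i} {j} e = FinP.toℕ-injective (distinct (toℕ i) (toℕ j) (FinP.toℕ<n i) (FinP.toℕ<n j) e)
  c-edge : ∀ (i : Fin (2 + k)) → a (c (inject₁ i)) (c (fsuc i)) ≡ true
  c-edge i rewrite FinP.toℕ-inject₁ i = edge (toℕ i) (s≤s (FinP.toℕ<n i))
  c-closing : a (c (fromℕ (2 + k))) (c fzero) ≡ true
  c-closing rewrite FinP.toℕ-fromℕ (2 + k) = closing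

least-witness : (P : ℕ → Set) → (∀ n → Dec (P n)) → ∀ K → P K →
                Σ ℕ (λ J → J ≤ K × P J × (∀ j → j < J → ¬ P j))
least-witness P P? zero    pK = 0 , z≤n , pK , (λ j ())
least-witness P P? (suc K) pK with P? 0
... | yes p0  = 0 , z≤n , p0 , (λ j ())
... | no ¬p0 with least-witness (P ∘ suc) (P? ∘ suc) K pK
... | J , J≤K , pJ , below = suc J , s≤s J≤K , pJ , below′
  where
  below′ : ∀ j → j < suc J → ¬ P j
  below′ zero    _        = ¬p0
  below′ (suc j) (s≤s j<J) = below j j<J

module RootedTree {t : ℕ} {a : Fin (suc t) → Fin (suc t) → Bool} (tree : IsTree (suc t) a) (y : Fin (suc t)) where
  T : FinGraph
  T = finGraph (suc t) a

  open Distance T MemP.∈-allFin public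
  open Connected (IsTree.connected tree) public

  adj-sym : ∀ u v → a u v ≡ a v u
  adj-sym = IsTree.symmetric tree

  height : Fin (suc t) → ℕ
  height v = dist T v y

  parentAt : ∀ v k → height v ≡ k → Fin (suc t)
  parentAt v zero    _ = v
  parentAt v (suc n) e = proj₁ (descend v y n e)

  parent : Fin (suc t) → Fin (suc t)
  parent v = parentAt v (height v) refl

  parent-spec : ∀ v n → height v ≡ suc n → a v (parent v) ≡ true × height (parent v) ≡ n
  parent-spec v n e = spec (height v) refl e
    where
    spec : ∀ k (e′ : height v ≡ k) → k ≡ suc n → a v (parentAt v k e′) ≡ true × height (parentAt v k e′) ≡ n
    spec .(suc n) e′ refl = proj₂ (descend v y n e′)

  parent-root : ∀ v → height v ≡ 0 → parent v ≡ v
  parent-root v e = root (height v) refl e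
    where
    root : ∀ k (e′ : height v ≡ k) → k ≡ 0 → parentAt v k e′ ≡ v
    root .0 e′ refl = refl

  -- anc j v: the ancestor of v  j  levels higher (the root is its own parent)
  anc : ℕ → Fin (suc t) → Fin (suc t)
  anc zero    v = v
  anc (suc j) v = parent (anc j v)

  height-anc : ∀ j v → height (anc j v) ≡ height v ∸ j
  height-anc zero    v = refl
  height-anc (suc j) v = trans (height-parent (anc j v) (height v ∸ j) (height-anc j v)) (pred[m∸n]≡m∸[1+n] (height v) j)
    where
    height-parent : ∀ w k → height w ≡ k → height (parent w) ≡ pred k
    height-parent w zero    e = trans (cong height (parent-root w e)) e
    height-parent w (suc n) e = proj₂ (parent-spec w n e)

  anc-edge : ∀ j v → j < height v → a (anc j v) (anc (suc j) v) ≡ true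
  anc-edge j v j<h with height v ∸ j in e | height-anc j v
  ... | zero  | _  = ⊥-elim (<⇒≱ j<h (m∸n≡0⇒m≤n e))
  ... | suc n | eh = proj₁ (parent-spec (anc j v) n eh)

  anc-root : ∀ v → anc (height v) v ≡ y
  anc-root v = zero⇒≡ _ y (trans (height-anc (height v) v) (n∸n≡0 (height v)))

  -- Two distinct vertices u, w of the same height K first have a common
  -- ancestor after J = suc J' steps.  The walk climbing from u to that
  -- ancestor and descending to w, possibly continued to a vertex v, visits
  -- distinct vertices: heights separate distinct positions on one branch,
  -- minimality of J separates the two branches.
  module Loop (u w : Fin (suc t)) (K : ℕ) (hu : height u ≡ K) (hw : height w ≡ K)
              (J' : ℕ) (J≤K : suc J' ≤ K) (meet : anc (suc J') u ≡ anc (suc J') w)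
              (apart : ∀ j → j < suc J' → anc j u ≢ anc j w) (v : Fin (suc t)) where
    J : ℕ
    J = suc J'

    walk : ℕ → Fin (suc t)
    walk i with i ≤? J | i ≤? J + J
    ... | yes _ | _     = anc i u
    ... | no _  | yes _ = anc (J + J ∸ i) w
    ... | no _  | no _  = v

    data Position (i : ℕ) : Set where
      up   : i ≤ J → Position i
      down : (q : ℕ) → q < J → i ≡ J + J ∸ q → Position i
      top  : i ≡ suc (J + J) → Position i

    position : ∀ i → i ≤ suc (J + J) → Position i
    position i i≤ with i ≤? J
    ... | yes i≤J = up i≤J
    ... | no i≰J with m≤n⇒m<n∨m≡n i≤
    ... | inj₂ i≡ = top i≡
    ... | inj₁ (s≤s i≤2J) = down (J + J ∸ i) (subst (J + J ∸ i <_) (m+n∸m≡n J J) (∸-monoʳ-< (≰⇒> i≰J) i≤2J))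
                                 (sym (m∸[m∸n]≡n i≤2J))

    walk-up : ∀ i → i ≤ J → walk i ≡ anc i u
    walk-up i i≤J with i ≤? J
    ... | yes _   = refl
    ... | no i≰J = ⊥-elim (i≰J i≤J)

    walk-down : ∀ q → q < J → walk (J + J ∸ q) ≡ anc q w
    walk-down q q<J with (J + J ∸ q) ≤? J | (J + J ∸ q) ≤? J + J
    ... | yes ≤J | _ = ⊥-elim (<⇒≱ J<i ≤J)
      where
      J<i : J < J + J ∸ q
      J<i = subst (J <_) (sym (+-∸-assoc J (<⇒≤ q<J)))
                  (subst (_< J + (J ∸ q)) (+-identityʳ J) (+-monoʳ-< J (m<n⇒0<n∸m q<J)))
    ... | no _ | yes _    = cong (λ k → anc k w) (m∸[m∸n]≡n (≤-trans (<⇒≤ q<J) (m≤m+n J J)))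
    ... | no _ | no ≰2J = ⊥-elim (≰2J (m∸n≤m (J + J) q))

    walk-top : walk (suc (J + J)) ≡ v
    walk-top with suc (J + J) ≤? J | suc (J + J) ≤? J + J
    ... | yes ≤J | _     = ⊥-elim (1+n≰n (≤-trans ≤J (m≤m+n J J)))
    ... | no _   | yes ≤2J = ⊥-elim (1+n≰n ≤2J)
    ... | no _   | no _  = refl

    height-up : ∀ i → i ≤ J → height (walk i) ≡ K ∸ i
    height-up i i≤J = trans (cong height (walk-up i i≤J)) (trans (height-anc i u) (cong (_∸ i) hu))

    height-down : ∀ q → q < J → height (walk (J + J ∸ q)) ≡ K ∸ q
    height-down q q<J = trans (cong height (walk-down q q<J)) (trans (height-anc q w) (cong (_∸ q) hw))

    level-injective : ∀ {i j} → i ≤ J → j ≤ J → K ∸ i ≡ K ∸ j → i ≡ j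
    level-injective i≤J j≤J = ∸-cancelˡ-≡ (≤-trans i≤J J≤K) (≤-trans j≤J J≤K)

    branches-apart : ∀ i q → i ≤ J → q < J → walk i ≢ walk (J + J ∸ q)
    branches-apart i q i≤J q<J e = apart q q<J (trans (sym (cong (λ k → anc k u) i≡q)) ancestors)
      where
      i≡q : i ≡ q
      i≡q = level-injective i≤J (<⇒≤ q<J) (trans (sym (height-up i i≤J)) (trans (cong height e) (height-down q q<J)))
      ancestors : anc i u ≡ anc q w
      ancestors = trans (sym (walk-up i i≤J)) (trans e (walk-down q q<J))

    top-apart : height v ≡ suc K → ∀ j → height (walk j) ≤ K → walk (suc (J + J)) ≢ walk j
    top-apart hv j low e = 1+n≰n (≤-trans (≤-reflexive (sym hv)) (≤-trans (≤-reflexive (cong height (trans (sym walk-top) e))) low))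

    distinct : ∀ L → L ≤ 2 + (J + J) → (suc (J + J) < L → height v ≡ suc K) →
               ∀ i j → i < L → j < L → walk i ≡ walk j → i ≡ j
    distinct L L≤ hv i j i<L j<L e with position i (s≤s⁻¹ (≤-trans i<L L≤)) | position j (s≤s⁻¹ (≤-trans j<L L≤))
    ... | up i≤J | up j≤J =
          level-injective i≤J j≤J (trans (sym (height-up i i≤J)) (trans (cong height e) (height-up j j≤J)))
    ... | down q q<J refl | down q′ q′<J refl =
          cong (J + J ∸_) (level-injective (<⇒≤ q<J) (<⇒≤ q′<J)
            (trans (sym (height-down q q<J)) (trans (cong height e) (height-down q′ q′<J))))
    ... | up i≤J | down q q<J refl = ⊥-elim (branches-apart i q i≤J q<J e)
    ... | down q q<J refl | up j≤J = ⊥-elim (branches-apart j q j≤J q<J (sym e))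
    ... | top refl | top refl = refl
    ... | top refl | up j≤J = ⊥-elim (top-apart (hv i<L) j (≤-trans (≤-reflexive (height-up j j≤J)) (m∸n≤m K j)) e)
    ... | top refl | down q q<J refl = ⊥-elim (top-apart (hv i<L) j (≤-trans (≤-reflexive (height-down q q<J)) (m∸n≤m K q)) e)
    ... | up i≤J | top refl = ⊥-elim (top-apart (hv j<L) i (≤-trans (≤-reflexive (height-up i i≤J)) (m∸n≤m K i)) (sym e))
    ... | down q q<J refl | top refl = ⊥-elim (top-apart (hv j<L) i (≤-trans (≤-reflexive (height-down q q<J)) (m∸n≤m K q)) (sym e))

    adj-along : ∀ {p q p' q'} → p ≡ p' → q ≡ q' → a p' q' ≡ true → a p q ≡ true
    adj-along refl refl pq = pq

    edge : ∀ L → L ≤ 2 + (J + J) → (suc (J + J) < L → a w v ≡ true) →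
           ∀ i → suc i < L → a (walk i) (walk (suc i)) ≡ true
    edge L L≤ wv i i+1<L with position i (s≤s⁻¹ (≤-trans (<⇒≤ i+1<L) L≤))
    ... | up i≤J with m≤n⇒m<n∨m≡n i≤J
    ...   | inj₁ i<J = adj-along (walk-up i i≤J) (walk-up (suc i) i<J)
                                  (anc-edge i u (≤-trans i<J (≤-trans J≤K (≤-reflexive (sym hu)))))
    ...   | inj₂ refl = adj-along (trans (walk-up J ≤-refl) meet) (trans (cong walk J+1) (walk-down J' ≤-refl))
                                   (trans (adj-sym _ _) (anc-edge J' w (≤-trans J≤K (≤-reflexive (sym hw)))))
      where
      J+1 : suc J ≡ J + J ∸ J'
      J+1 = sym (trans (+-∸-assoc J {J} {J'} (n≤1+n J')) (trans (cong (J +_) (m+n∸n≡m 1 J')) (+-comm J 1)))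
    edge L L≤ wv i i+1<L | down zero q<J refl = adj-along (walk-down 0 q<J) walk-top (wv i+1<L)
    edge L L≤ wv i i+1<L | down (suc q) q<J refl =
      adj-along (walk-down (suc q) q<J) (trans (cong walk next) (walk-down q (≤-trans (n≤1+n _) q<J)))
                 (trans (adj-sym _ _) (anc-edge q w (≤-trans (<⇒≤ q<J) (≤-trans J≤K (≤-reflexive (sym hw))))))
      where
      next : suc (J + J ∸ suc q) ≡ J + J ∸ q
      next = sym (+-∸-assoc 1 {J + J} {suc q} (≤-trans (<⇒≤ q<J) (m≤m+n J J)))
    edge L L≤ wv i i+1<L | top refl = ⊥-elim (1+n≰n (≤-trans i+1<L L≤))

    closes : ∀ L → 3 ≤ L → L ≤ 2 + (J + J) → (suc (J + J) < L → height v ≡ suc K) →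
             (suc (J + J) < L → a w v ≡ true) → a (walk (pred L)) u ≡ true → HasCycle a
    closes (suc (suc (suc k))) (s≤s (s≤s (s≤s _))) L≤ hv wv closing =
      closedWalk⇒cycle a k walk (distinct _ L≤ hv) (edge _ L≤ wv)
                        (subst (λ z → a (walk (2 + k)) z ≡ true) (sym (walk-up 0 z≤n)) closing)

  common-ancestor : ∀ u w K → height u ≡ K → height w ≡ K → anc K u ≡ anc K w
  common-ancestor u w K hu hw = trans (subst (λ k → anc k u ≡ y) hu (anc-root u)) (sym (subst (λ k → anc k w ≡ y) hw (anc-root w)))

  FirstMeeting : Fin (suc t) → Fin (suc t) → ℕ → Set
  FirstMeeting u w K = Σ ℕ λ J' → suc J' ≤ K × anc (suc J') u ≡ anc (suc J') w × (∀ j → j < suc J' → anc j u ≢ anc j w)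

  first-meeting : ∀ u w K → height u ≡ K → height w ≡ K → u ≢ w → FirstMeeting u w K
  first-meeting u w K hu hw u≢w
    with least-witness (λ j → anc j u ≡ anc j w) (λ j → anc j u Fin.≟ anc j w) K (common-ancestor u w K hu hw)
  ... | zero , _ , u≡w , _ = ⊥-elim (u≢w u≡w)
  ... | suc J' , J≤K , meet , apart = J' , J≤K , meet , apart

  adjacent-levels-differ : ∀ u w → a u w ≡ true → height u ≢ height w
  adjacent-levels-differ u w uw same with u Fin.≟ w
  ... | yes refl with () ← trans (sym uw) (IsTree.irreflexive tree u)
  ... | no u≢w with first-meeting u w (height u) refl (sym same) u≢w
  ... | J' , J≤K , meet , apart =
    IsTree.acyclic tree (W.closes (suc (W.J + W.J)) three (n≤1+n _) (⊥-elim ∘ 1+n≰n) (⊥-elim ∘ 1+n≰n) closing)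
    where
    module W = Loop u w (height u) refl (sym same) J' J≤K meet apart u
    three : 3 ≤ suc (W.J + W.J)
    three = s≤s (s≤s (≤-trans (s≤s z≤n) (m≤n+m W.J J')))
    closing : a (W.walk (W.J + W.J)) u ≡ true
    closing = subst (λ z → a z u ≡ true) (sym (W.walk-down 0 (s≤s z≤n))) (trans (adj-sym w u) uw)

  lower-neighbour-unique : ∀ v w₁ w₂ n → height v ≡ suc n → a v w₁ ≡ true → height w₁ ≡ n →
                           a v w₂ ≡ true → height w₂ ≡ n → w₁ ≡ w₂
  lower-neighbour-unique v w₁ w₂ n hv vw₁ h₁ vw₂ h₂ with w₁ Fin.≟ w₂
  ... | yes w₁≡w₂ = w₁≡w₂
  ... | no w₁≢w₂ with first-meeting w₁ w₂ n h₁ h₂ w₁≢w₂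
  ... | J' , J≤K , meet , apart =
    ⊥-elim (IsTree.acyclic tree (W.closes (2 + (W.J + W.J)) (s≤s (s≤s (s≤s z≤n))) ≤-refl
                                          (λ _ → hv) (λ _ → trans (adj-sym w₂ v) vw₂) closing))
    where
    module W = Loop w₁ w₂ n h₁ h₂ J' J≤K meet apart v
    closing : a (W.walk (suc (W.J + W.J))) w₁ ≡ true
    closing = subst (λ z → a z w₁ ≡ true) (sym W.walk-top) vw₁

  adjacent-levels : ∀ u w → a u w ≡ true → height u ≡ suc (height w) ⊎ height w ≡ suc (height u)
  adjacent-levels u w uw with m≤n⇒m<n∨m≡n (step u w y uw) | m≤n⇒m<n∨m≡n (step w u y (trans (adj-sym w u) uw))
  ... | inj₂ hu≡ | _      = inj₁ hu≡
  ... | inj₁ _   | inj₂ hw≡ = inj₂ hw≡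
  ... | inj₁ (s≤s hu≤hw) | inj₁ (s≤s hw≤hu) = ⊥-elim (adjacent-levels-differ u w uw (≤-antisym hu≤hw hw≤hu))

  -- Handshake lemma: orienting each edge towards the root, every non-root
  -- vertex is the lower end of exactly one edge, so Σ deg = 2 t.
  lowerEdge : Fin (suc t) → Fin (suc t) → ℕ
  lowerEdge v w = [ a v w ] * [ isYes (height v ≟ℕ suc (height w)) ]

  level-gap : ∀ {m n} → m ≡ suc n → n ≢ suc m
  level-gap refl n≡ = <⇒≢ (m<n⇒m<1+n (n<1+n _)) n≡

  edge-oriented : ∀ v w → [ a v w ] ≡ lowerEdge v w + lowerEdge w v
  edge-oriented v w with a v w in vw | a w v in wv
  ... | false | false = refl
  ... | false | true  with () ← trans (sym vw) (trans (adj-sym v w) wv)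
  ... | true  | false with () ← trans (sym wv) (trans (adj-sym w v) vw)
  ... | true  | true  with adjacent-levels v w vw
  ...   | inj₁ hv≡ rewrite [yes] (height v ≟ℕ suc (height w)) hv≡ | [no] (height w ≟ℕ suc (height v)) (level-gap hv≡) = refl
  ...   | inj₂ hw≡ rewrite [yes] (height w ≟ℕ suc (height v)) hw≡ | [no] (height v ≟ℕ suc (height w)) (level-gap hw≡) = refl

  nonRoot : Fin (suc t) → ℕ
  nonRoot v = [ not (isYes (v Fin.≟ y)) ]

  lowerEdges-from : ∀ v → sumFin (suc t) (lowerEdge v) ≡ nonRoot v
  lowerEdges-from v = byRoot (v Fin.≟ y)
    where
    byRoot : (d : Dec (v ≡ y)) → sumFin (suc t) (lowerEdge v) ≡ [ not (isYes d) ]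
    byRoot (yes v≡y) = sumL-vanish (allFin (suc t)) fromRoot
      where
      atRoot : height v ≡ 0
      atRoot = trans (cong height v≡y) (diagonal y)
      fromRoot : ∀ w → lowerEdge v w ≡ 0
      fromRoot w = trans (cong ([ a v w ] *_) ([no] (height v ≟ℕ suc (height w)) (λ e → 0≢1+n (trans (sym atRoot) e))))
                         (*-zeroʳ [ a v w ])
    byRoot (no v≢y) = belowRoot (height v) refl
      where
      belowRoot : ∀ k → height v ≡ k → sumFin (suc t) (lowerEdge v) ≡ 1
      belowRoot zero    hv = ⊥-elim (v≢y (zero⇒≡ v y hv))
      belowRoot (suc n) hv = trans (sumFin-single (suc t) (parent v) (lowerEdge v) others) atParent
        where
        toParent : a v (parent v) ≡ true × height (parent v) ≡ n
        toParent = parent-spec v n hv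
        atParent : [ a v (parent v) ] * [ isYes (height v ≟ℕ suc (height (parent v))) ] ≡ 1
        atParent rewrite proj₁ toParent | [yes] (height v ≟ℕ suc (height (parent v))) (trans hv (cong suc (sym (proj₂ toParent)))) = refl
        others : ∀ w → w ≢ parent v → [ a v w ] * [ isYes (height v ≟ℕ suc (height w)) ] ≡ 0
        others w w≢p with a v w in vw | height v ≟ℕ suc (height w)
        ... | false | _     = refl
        ... | true  | no _  = refl
        ... | true  | yes e = ⊥-elim (w≢p (lower-neighbour-unique v w (parent v) n hv vw
                                              (suc-injective (trans (sym e) hv)) (proj₁ toParent) (proj₂ toParent)))

  nonRoot-sum : sumFin (suc t) nonRoot ≡ t
  nonRoot-sum = begin
      sumFin (suc t) nonRoot                        ≡⟨ sumFin-punchIn t y nonRoot ⟩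
      nonRoot y + sumFin t (nonRoot ∘ punchIn y)    ≡⟨ cong₂ _+_ (cong (λ b → [ not b ]) (isYes-intro (y Fin.≟ y) refl))
                                                             (sumFin-cong t (λ j → cong (λ b → [ not b ]) (isYes-no (punchIn y j Fin.≟ y) (FinP.punchInᵢ≢i y j)))) ⟩
      sumFin t (λ _ → 1)                             ≡⟨ trans (sumFin-const t 1) (*-identityʳ t) ⟩
      t ∎
    where open ≡-Reasoning

  degree-sum : sumFin (suc t) (deg T) ≡ t + t
  degree-sum = begin
      sumFin (suc t) (λ v → sumFin (suc t) (λ w → [ a v w ]))
        ≡⟨ sumFin-cong (suc t) (λ v → trans (sumFin-cong (suc t) (edge-oriented v)) (sumL-+ (allFin (suc t)) (lowerEdge v) (λ w → lowerEdge w v))) ⟩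
      sumFin (suc t) (λ v → sumFin (suc t) (lowerEdge v) + sumFin (suc t) (λ w → lowerEdge w v))
        ≡⟨ sumL-+ (allFin (suc t)) (λ v → sumFin (suc t) (lowerEdge v)) (λ v → sumFin (suc t) (λ w → lowerEdge w v)) ⟩
      lowerEdges + sumFin (suc t) (λ v → sumFin (suc t) (λ w → lowerEdge w v))
        ≡⟨ cong (lowerEdges +_) (sumL-swap (allFin (suc t)) (allFin (suc t)) (λ v w → lowerEdge w v)) ⟩
      lowerEdges + lowerEdges
        ≡⟨ cong₂ _+_ count count ⟩
      t + t ∎
    where
    open ≡-Reasoning
    lowerEdges : ℕ
    lowerEdges = sumFin (suc t) (λ v → sumFin (suc t) (lowerEdge v))
    count : lowerEdges ≡ t
    count = trans (sumFin-cong (suc t) lowerEdges-from) nonRoot-sum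

≡ᵇ-intro : ∀ {m n} → m ≡ n → (m ≡ᵇ n) ≡ true
≡ᵇ-intro {m} {n} m≡n = Equivalence.to T-≡ (≡⇒≡ᵇ m n m≡n)

≡ᵇ-elim : ∀ m n → (m ≡ᵇ n) ≡ true → m ≡ n
≡ᵇ-elim m n e = ≡ᵇ⇒≡ m n (Equivalence.from T-≡ e)

∨-swap-pairs : ∀ p q c d → p ∨ q ∨ c ∨ d ≡ q ∨ p ∨ d ∨ c
∨-swap-pairs true  true  c d = refl
∨-swap-pairs true  false c d = refl
∨-swap-pairs false true  c d = refl
∨-swap-pairs false false true  true  = refl
∨-swap-pairs false false true  false = refl
∨-swap-pairs false false false true  = refl
∨-swap-pairs false false false false = refl

module CycleGraph (k : ℕ) where
  r : ℕ
  r = 3 + k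

  C : FinGraph
  C = cycle r

  open Distance C MemP.∈-allFin public

  adjℕ : ℕ → ℕ → Bool
  adjℕ i j = (j ≡ᵇ suc i) ∨ (i ≡ᵇ suc j) ∨ ((i ≡ᵇ 0) ∧ (suc j ≡ᵇ r)) ∨ ((j ≡ᵇ 0) ∧ (suc i ≡ᵇ r))

  adj-sym : ∀ a b → cycAdj r a b ≡ cycAdj r b a
  adj-sym a b = ∨-swap-pairs (toℕ b ≡ᵇ suc (toℕ a)) (toℕ a ≡ᵇ suc (toℕ b))
                             ((toℕ a ≡ᵇ 0) ∧ (suc (toℕ b) ≡ᵇ r)) ((toℕ b ≡ᵇ 0) ∧ (suc (toℕ a) ≡ᵇ r))

  reach-zero : ∀ n (a : Fin r) → toℕ a ≡ n → R n a fzero ≡ true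
  reach-zero zero    a a≡0 = subst (λ w → R 0 a w ≡ true) (FinP.toℕ-injective a≡0) (reach-refl a)
  reach-zero (suc n) a a≡  = reach-step n a p fzero a~p (reach-zero n p (FinP.toℕ-fromℕ< n<r))
    where
    n<r : n < r
    n<r = ≤-trans (n≤1+n (suc n)) (subst (λ m → suc m ≤ r) a≡ (FinP.toℕ<n a))
    p : Fin r
    p = fromℕ< n<r
    a~p : cycAdj r a p ≡ true
    a~p = ∨-introʳ (toℕ p ≡ᵇ suc (toℕ a)) (∨-introˡ _ (≡ᵇ-intro (trans a≡ (cong suc (sym (FinP.toℕ-fromℕ< n<r))))))

  -- C_r is connected: walk from u down to 0 and back up to v
  connected : ∀ u v → Σ ℕ (λ n → R n u v ≡ true)
  connected u v = toℕ u + toℕ v , reach-trans (toℕ u) (toℕ v) u fzero v (reach-zero (toℕ u) u refl)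
                                              (reach-sym adj-sym (toℕ v) v fzero (reach-zero (toℕ v) v refl))

  open Connected connected public

  next : ℕ → ℕ
  next i with suc i ≟ℕ r
  ... | yes _ = 0
  ... | no _  = suc i

  prev : ℕ → ℕ
  prev zero    = 2 + k
  prev (suc i) = i

  next<r : ∀ i → i < r → next i < r
  next<r i i<r with suc i ≟ℕ r
  ... | yes _     = s≤s z≤n
  ... | no 1+i≢r = ≤∧≢⇒< i<r 1+i≢r

  prev<r : ∀ i → i < r → prev i < r
  prev<r zero    _   = ≤-refl
  prev<r (suc i) i<r = ≤-trans (n≤1+n _) i<r

  next≢prev : ∀ i → next i ≢ prev i
  next≢prev i with suc i ≟ℕ r
  next≢prev zero    | yes ()
  next≢prev (suc i) | yes 2+i≡r = λ 0≡i → 0≢1+n (suc-injective (suc-injective (trans (cong (suc ∘ suc) 0≡i) 2+i≡r)))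
  next≢prev zero    | no _      = λ ()
  next≢prev (suc i) | no _      = λ 2+i≡i → <⇒≢ (m<n⇒m<1+n (n<1+n i)) (sym 2+i≡i)

  next-spec : ∀ i → (suc i ≡ r × next i ≡ 0) ⊎ (suc i ≢ r × next i ≡ suc i)
  next-spec i with suc i ≟ℕ r
  ... | yes last = inj₁ (last , refl)
  ... | no ¬last = inj₂ (¬last , refl)

  adjℕ-up : ∀ i j → j ≡ suc i → adjℕ i j ≡ true
  adjℕ-up i j e = ∨-introˡ _ (≡ᵇ-intro e)

  adjℕ-down : ∀ i j → i ≡ suc j → adjℕ i j ≡ true
  adjℕ-down i j e = ∨-introʳ (j ≡ᵇ suc i) (∨-introˡ _ (≡ᵇ-intro e))

  adjℕ-wrapDown : ∀ i j → i ≡ 0 → suc j ≡ r → adjℕ i j ≡ true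
  adjℕ-wrapDown i j refl e = ∨-introʳ (j ≡ᵇ 1) (∨-introʳ (0 ≡ᵇ suc j) (∨-introˡ _ (≡ᵇ-intro e)))

  adjℕ-wrapUp : ∀ i j → j ≡ 0 → suc i ≡ r → adjℕ i j ≡ true
  adjℕ-wrapUp i j refl e = ∨-introʳ (0 ≡ᵇ suc i) (∨-introʳ (i ≡ᵇ 1) (∨-introʳ ((i ≡ᵇ 0) ∧ (1 ≡ᵇ r)) (≡ᵇ-intro e)))

  next-adj : ∀ i → adjℕ i (next i) ≡ true
  next-adj i with next-spec i
  ... | inj₁ (last , n≡0) = adjℕ-wrapUp i (next i) n≡0 last
  ... | inj₂ (_ , n≡)     = adjℕ-up i (next i) n≡

  prev-adj : ∀ i → adjℕ i (prev i) ≡ true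
  prev-adj zero    = adjℕ-wrapDown 0 (prev 0) refl refl
  prev-adj (suc i) = adjℕ-down (suc i) i refl

  adjℕ-neighbour : ∀ i j → j < r → adjℕ i j ≡ true → j ≡ next i ⊎ j ≡ prev i
  adjℕ-neighbour i j j<r i~j with ∨-cases _ _ i~j
  ... | inj₁ j≡i+1 = inj₁ (successor (≡ᵇ-elim j (suc i) j≡i+1))
    where
    successor : j ≡ suc i → j ≡ next i
    successor j≡ with next-spec i
    ... | inj₁ (last , _)  = ⊥-elim (<-irrefl (trans j≡ last) j<r)
    ... | inj₂ (_ , n≡)    = trans j≡ (sym n≡)
  ... | inj₂ rest with ∨-cases _ _ rest
  ... | inj₁ i≡j+1 = inj₂ (sym (cong prev (≡ᵇ-elim i (suc j) i≡j+1)))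
  ... | inj₂ rest′ with ∨-cases _ _ rest′
  ... | inj₁ wrapBack with ∧-split _ _ wrapBack
  ...   | i≡0 , j+1≡r rewrite ≡ᵇ-elim i 0 i≡0 = inj₂ (suc-injective (≡ᵇ-elim (suc j) r j+1≡r))
  adjℕ-neighbour i j j<r i~j | inj₂ _ | inj₂ _ | inj₂ wrapForward with ∧-split _ _ wrapForward
  ...   | j≡0 , i+1≡r with next-spec i
  ...     | inj₁ (_ , n≡0)   = inj₁ (trans (≡ᵇ-elim j 0 j≡0) (sym n≡0))
  ...     | inj₂ (¬last , _) = ⊥-elim (¬last (≡ᵇ-elim (suc i) r i+1≡r))

  [adjℕ] : ∀ i j → j < r → [ adjℕ i j ] ≡ [ isYes (j ≟ℕ next i) ] + [ isYes (j ≟ℕ prev i) ]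
  [adjℕ] i j j<r with j ≟ℕ next i | j ≟ℕ prev i
  ... | yes j≡n | yes j≡p = ⊥-elim (next≢prev i (trans (sym j≡n) j≡p))
  ... | yes refl | no _   = cong [_] (next-adj i)
  ... | no _   | yes refl = cong [_] (prev-adj i)
  ... | no ¬n  | no ¬p with adjℕ i j in i~j
  ...   | false = refl
  ...   | true with adjℕ-neighbour i j j<r i~j
  ...     | inj₁ j≡n = ⊥-elim (¬n j≡n)
  ...     | inj₂ j≡p = ⊥-elim (¬p j≡p)

  label-unique : ∀ s → s < r → sumFin r (λ b → [ isYes (toℕ b ≟ℕ s) ]) ≡ 1
  label-unique s s<r = begin
      sumFin r (λ b → [ isYes (toℕ b ≟ℕ s) ])
        ≡⟨ sumFin-cong r (λ b → [isYes]-cong (toℕ b ≟ℕ s) (b Fin.≟ c) (λ e → FinP.toℕ-injective (trans e (sym toℕ-c)))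
                                                                       (λ e → trans (cong toℕ e) toℕ-c)) ⟩
      sumFin r (λ b → δ b c)
        ≡⟨ sumFin-single r c (λ b → δ b c) (λ b → δ-off) ⟩
      δ c c
        ≡⟨ δ-self c ⟩
      1 ∎
    where
    open ≡-Reasoning
    c : Fin r
    c = fromℕ< s<r
    toℕ-c : toℕ c ≡ s
    toℕ-c = FinP.toℕ-fromℕ< s<r

  degree-two : ∀ a → deg C a ≡ 2
  degree-two a = begin
      sumFin r (λ b → [ adjℕ (toℕ a) (toℕ b) ])
        ≡⟨ sumFin-cong r (λ b → [adjℕ] (toℕ a) (toℕ b) (FinP.toℕ<n b)) ⟩
      sumFin r (λ b → [ isYes (toℕ b ≟ℕ next (toℕ a)) ] + [ isYes (toℕ b ≟ℕ prev (toℕ a)) ])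
        ≡⟨ sumL-+ (allFin r) (λ b → [ isYes (toℕ b ≟ℕ next (toℕ a)) ]) (λ b → [ isYes (toℕ b ≟ℕ prev (toℕ a)) ]) ⟩
      sumFin r (λ b → [ isYes (toℕ b ≟ℕ next (toℕ a)) ]) + sumFin r (λ b → [ isYes (toℕ b ≟ℕ prev (toℕ a)) ])
        ≡⟨ cong₂ _+_ (label-unique _ (next<r _ (FinP.toℕ<n a))) (label-unique _ (prev<r _ (FinP.toℕ<n a))) ⟩
      2 ∎
    where open ≡-Reasoning

pattern cyc a    = inj₁ a
pattern tv i u   = inj₂ (i , u)

module GluedGraph (k : ℕ) (F : Family (3 + k)) (trees : ∀ i → IsTree (suc (Family.t F i)) (Family.tadj F i)) where
  open Family F

  module Cyc = CycleGraph k
  module Tree (i : Fin m) = RootedTree (trees i) (y i)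

  G : FinGraph
  G = glued F

  dC : Fin (3 + k) → Fin (3 + k) → ℕ
  dC = dist (cycle (3 + k))

  dT : (i : Fin m) → Fin (suc (t i)) → Fin (suc (t i)) → ℕ
  dT i = dist (tree F i)

  -- u : Fin (t i) stands for the vertex emb i u ≠ y i of T_i
  emb : (i : Fin m) → Fin (t i) → Fin (suc (t i))
  emb i = punchIn (y i)

  emb≢y : ∀ i u → emb i u ≢ y i
  emb≢y i = FinP.punchInᵢ≢i (y i)

  tree-vertex : ∀ i z → z ≡ y i ⊎ Σ (Fin (t i)) (λ u → emb i u ≡ z)
  tree-vertex i z with z Fin.≟ y i
  ... | yes z≡y = inj₁ z≡y
  ... | no z≢y  = inj₂ (punchOut (z≢y ∘ sym) , FinP.punchIn-punchOut (z≢y ∘ sym))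

  up : (i : Fin m) → Fin (t i) → ℕ
  up i u = dT i (emb i u) (y i)

  complete : ∀ v → v ∈ FinGraph.verts G
  complete (cyc a)  = MemP.∈-++⁺ˡ (MemP.∈-map⁺ inj₁ (MemP.∈-allFin a))
  complete (tv i u) = MemP.∈-++⁺ʳ (map inj₁ (allFin (3 + k)))
    (MemP.∈-concat⁺′ (MemP.∈-map⁺ (λ u → tv i u) (MemP.∈-allFin u))
                     (MemP.∈-map⁺ (λ i → map (λ u → tv i u) (allFin (t i))) (MemP.∈-allFin i)))

  -- The distance in G: inside one tree it is the tree distance, otherwise a
  -- path climbs to the cycle, runs along it, and descends into the target tree.
  dG : VG F → VG F → ℕ
  dG (cyc a)  (cyc b)  = dC a b
  dG (cyc a)  (tv j w) = dC a (x j) + dT j (y j) (emb j w)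
  dG (tv i u) (cyc b)  = up i u + dC (x i) b
  dG (tv i u) (tv j w) with i Fin.≟ j
  ... | yes refl = dT i (emb i u) (emb i w)
  ... | no _     = up i u + dC (x i) (x j) + dT j (y j) (emb j w)

  dG-same : ∀ i u w → dG (tv i u) (tv i w) ≡ dT i (emb i u) (emb i w)
  dG-same i u w with i Fin.≟ i
  ... | yes refl = refl
  ... | no i≢i   = ⊥-elim (i≢i refl)

  dG-other : ∀ i j u w → i ≢ j → dG (tv i u) (tv j w) ≡ up i u + dC (x i) (x j) + dT j (y j) (emb j w)
  dG-other i j u w i≢j with i Fin.≟ j
  ... | yes i≡j = ⊥-elim (i≢j i≡j)
  ... | no _    = refl

  adj-same : ∀ i u w → adjG F (tv i u) (tv i w) ≡ tadj i (emb i u) (emb i w)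
  adj-same i u w with i Fin.≟ i
  ... | yes refl = refl
  ... | no i≢i   = ⊥-elim (i≢i refl)

  adj-other : ∀ i j u w → i ≢ j → adjG F (tv i u) (tv j w) ≡ false
  adj-other i j u w i≢j with i Fin.≟ j
  ... | yes i≡j = ⊥-elim (i≢j i≡j)
  ... | no _    = refl

  dG-zero⇒≡ : ∀ p q → dG p q ≡ 0 → p ≡ q
  dG-zero⇒≡ (cyc a)  (cyc b)  d≡0 = cong inj₁ (Cyc.zero⇒≡ a b d≡0)
  dG-zero⇒≡ (cyc a)  (tv j w) d≡0 = ⊥-elim (emb≢y j w (sym (Tree.zero⇒≡ j (y j) (emb j w) (m+n≡0⇒n≡0 (dC a (x j)) d≡0))))
  dG-zero⇒≡ (tv i u) (cyc b)  d≡0 = ⊥-elim (emb≢y i u (Tree.zero⇒≡ i (emb i u) (y i) (m+n≡0⇒m≡0 (up i u) d≡0)))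
  dG-zero⇒≡ (tv i u) (tv j w) d≡0 with i Fin.≟ j
  ... | yes refl = cong (tv i) (FinP.punchIn-injective (y i) u w (Tree.zero⇒≡ i (emb i u) (emb i w) d≡0))
  ... | no _     = ⊥-elim (emb≢y i u (Tree.zero⇒≡ i (emb i u) (y i) (m+n≡0⇒m≡0 (up i u) (m+n≡0⇒m≡0 (up i u + dC (x i) (x j)) d≡0))))

  dG-diagonal : ∀ v → dG v v ≡ 0
  dG-diagonal (cyc a)  = Cyc.diagonal a
  dG-diagonal (tv i u) = trans (dG-same i u u) (Tree.diagonal i (emb i u))

  up≤1 : ∀ i u → tadj i (emb i u) (y i) ≡ true → up i u ≤ 1
  up≤1 i u u~y = ≤-trans (Tree.step i (emb i u) (y i) (y i) u~y) (≤-reflexive (cong suc (Tree.diagonal i (y i))))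

  ≤-suc-+ : ∀ a b → a ≤ suc (b + a)
  ≤-suc-+ a b = ≤-trans (m≤n+m a b) (n≤1+n _)

  step-from-attachment : ∀ i u a v → x i ≡ a → tadj i (y i) (emb i u) ≡ true → dG (cyc a) v ≤ suc (dG (tv i u) v)
  step-from-attachment i u .(x i) (cyc c) refl _ = ≤-suc-+ (dC (x i) c) (up i u)
  step-from-attachment i u .(x i) (tv j w) refl y~u with i Fin.≟ j
  ... | yes refl = subst (λ z → z + dT i (y i) (emb i w) ≤ suc (dT i (emb i u) (emb i w))) (sym (Cyc.diagonal (x i)))
                         (Tree.step i (y i) (emb i u) (emb i w) y~u)
  ... | no _     = +-monoˡ-≤ (dT j (y j) (emb j w)) (≤-suc-+ (dC (x i) (x j)) (up i u))

  step-to-attachment : ∀ i u b v → x i ≡ b → tadj i (emb i u) (y i) ≡ true → dG (tv i u) v ≤ suc (dG (cyc b) v)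
  step-to-attachment i u .(x i) (cyc c) refl u~y = +-monoˡ-≤ (dC (x i) c) (up≤1 i u u~y)
  step-to-attachment i u .(x i) (tv j w) refl u~y with i Fin.≟ j
  ... | yes refl = subst (λ z → dT i (emb i u) (emb i w) ≤ suc (z + dT i (y i) (emb i w))) (sym (Cyc.diagonal (x i)))
                         (Tree.step i (emb i u) (y i) (emb i w) u~y)
  ... | no _     = +-monoˡ-≤ (dT j (y j) (emb j w)) (+-monoˡ-≤ (dC (x i) (x j)) (up≤1 i u u~y))

  step-within-tree : ∀ i u u′ v → tadj i (emb i u) (emb i u′) ≡ true → dG (tv i u) v ≤ suc (dG (tv i u′) v)
  step-within-tree i u u′ (cyc c) u~u′ = +-monoˡ-≤ (dC (x i) c) (Tree.step i (emb i u) (emb i u′) (y i) u~u′)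
  step-within-tree i u u′ (tv j w) u~u′ with i Fin.≟ j
  ... | yes refl = Tree.step i (emb i u) (emb i u′) (emb i w) u~u′
  ... | no _     = +-monoˡ-≤ (dT j (y j) (emb j w)) (+-monoˡ-≤ (dC (x i) (x j)) (Tree.step i (emb i u) (emb i u′) (y i) u~u′))

  dG-step : ∀ p q v → adjG F p q ≡ true → dG p v ≤ suc (dG q v)
  dG-step (cyc a) (cyc b) (cyc c)  a~b = Cyc.step a b c a~b
  dG-step (cyc a) (cyc b) (tv j w) a~b = +-monoˡ-≤ (dT j (y j) (emb j w)) (Cyc.step a b (x j) a~b)
  dG-step (cyc a) (tv i u) v a~u with ∧-split _ _ a~u
  ... | xi≡a , y~u = step-from-attachment i u a v (isYes-elim (x i Fin.≟ a) xi≡a) y~u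
  dG-step (tv i u) (cyc b) v u~b with ∧-split _ _ u~b
  ... | xi≡b , u~y = step-to-attachment i u b v (isYes-elim (x i Fin.≟ b) xi≡b) u~y
  dG-step (tv i u) (tv i′ u′) v u~u′ with i Fin.≟ i′
  ... | yes refl = step-within-tree i u u′ v u~u′
  dG-step (tv i u) (tv i′ u′) v () | no _

  attach : ∀ i u → tadj i (y i) (emb i u) ≡ true → adjG F (cyc (x i)) (tv i u) ≡ true
  attach i u y~u = trans (cong (_∧ tadj i (y i) (emb i u)) (isYes-intro (x i Fin.≟ x i) refl)) y~u

  detach : ∀ i u → tadj i (emb i u) (y i) ≡ true → adjG F (tv i u) (cyc (x i)) ≡ true
  detach i u u~y = trans (cong (_∧ tadj i (emb i u) (y i)) (isYes-intro (x i Fin.≟ x i) refl)) u~y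

  Closer : VG F → VG F → ℕ → Set
  Closer p v n = Σ (VG F) (λ q → adjG F p q ≡ true × dG q v ≡ n)

  descend-into-tree : ∀ j w n → dT j (y j) (emb j w) ≡ suc n → Closer (cyc (x j)) (tv j w) n
  descend-into-tree j w n d≡ with Tree.descend j (y j) (emb j w) n d≡
  ... | z , y~z , dz≡ with tree-vertex j z
  ...   | inj₁ z≡y = ⊥-elim (1+n≰n (≤-reflexive (trans (sym d≡) (trans (cong (λ s → dT j s (emb j w)) (sym z≡y)) dz≡))))
  ...   | inj₂ (z′ , refl) = tv j z′ , attach j z′ y~z , trans (dG-same j z′ w) dz≡

  -- from a tree vertex towards the attachment vertex, when every route to v passes x_i
  descend-to-attachment : ∀ i u n rest v → up i u ≡ suc n → dG (cyc (x i)) v ≡ rest →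
                          (∀ u′ → dG (tv i u′) v ≡ up i u′ + rest) → Closer (tv i u) v (n + rest)
  descend-to-attachment i u n rest v up≡ via-root via-tree with Tree.descend i (emb i u) (y i) n up≡
  ... | z , u~z , dz≡ with tree-vertex i z
  ...   | inj₁ z≡y = cyc (x i) , detach i u (subst (λ s → tadj i (emb i u) s ≡ true) z≡y u~z)
                    , trans via-root (cong (_+ rest) (trans (sym (Tree.diagonal i (y i))) (trans (cong (λ s → dT i s (y i)) (sym z≡y)) dz≡)))
  ...   | inj₂ (z′ , refl) = tv i z′ , trans (adj-same i u z′) u~z , trans (via-tree z′) (cong (_+ rest) dz≡)

  descend-within-tree : ∀ i u w n → dT i (emb i u) (emb i w) ≡ suc n → Closer (tv i u) (tv i w) n
  descend-within-tree i u w n d≡ with Tree.descend i (emb i u) (emb i w) n d≡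
  ... | z , u~z , dz≡ with tree-vertex i z
  ...   | inj₁ z≡y = cyc (x i) , detach i u (subst (λ s → tadj i (emb i u) s ≡ true) z≡y u~z)
                    , trans (cong (_+ dT i (y i) (emb i w)) (Cyc.diagonal (x i))) (trans (cong (λ s → dT i s (emb i w)) (sym z≡y)) dz≡)
  ...   | inj₂ (z′ , refl) = tv i z′ , trans (adj-same i u z′) u~z , trans (dG-same i z′ w) dz≡

  up-positive : ∀ i u → up i u ≢ 0
  up-positive i u up≡0 = emb≢y i u (Tree.zero⇒≡ i (emb i u) (y i) up≡0)

  dG-descend : ∀ p v n → dG p v ≡ suc n → Closer p v n
  dG-descend (cyc a) (cyc c) n d≡ with Cyc.descend a c n d≡
  ... | b , a~b , db≡ = cyc b , a~b , db≡
  dG-descend (cyc a) (tv j w) n d≡ with dC a (x j) in dC≡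
  ... | zero with refl ← Cyc.zero⇒≡ a (x j) dC≡ = descend-into-tree j w n d≡
  ... | suc n′ with Cyc.descend a (x j) n′ dC≡
  ...   | b , a~b , db≡ = cyc b , a~b , trans (cong (_+ dT j (y j) (emb j w)) db≡) (suc-injective d≡)
  dG-descend (tv i u) (cyc c) n d≡ with up i u in up≡
  ... | zero   = ⊥-elim (up-positive i u up≡)
  ... | suc n′ = subst (Closer (tv i u) (cyc c)) (suc-injective d≡)
                       (descend-to-attachment i u n′ (dC (x i) c) (cyc c) up≡ refl (λ _ → refl))
  dG-descend (tv i u) (tv j w) n d≡ with i Fin.≟ j
  ... | yes refl = descend-within-tree i u w n d≡
  ... | no i≢j with up i u in up≡
  ...   | zero   = ⊥-elim (up-positive i u up≡)
  ...   | suc n′ = subst (Closer (tv i u) (tv j w)) (trans (sym (+-assoc n′ _ _)) (suc-injective d≡))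
                         (descend-to-attachment i u n′ (dC (x i) (x j) + dT j (y j) (emb j w)) (tv j w) up≡ refl
                            (λ u′ → trans (dG-other i j u′ w i≢j) (+-assoc (up i u′) _ _)))

  dG-isWalkDistance : IsWalkDistance G dG
  dG-isWalkDistance = record
    { zero⇒≡ = dG-zero⇒≡ ; diagonal = dG-diagonal ; step = dG-step ; descend = dG-descend }

  dist-glued : ∀ p q → dist G p q ≡ dG p q
  dist-glued = Distance.dist≡walkDistance G complete dG-isWalkDistance

module DegreeDistance (k : ℕ) (F : Family (3 + k)) (trees : ∀ i → IsTree (suc (Family.t F i)) (Family.tadj F i)) where
  open Family F
  open GluedGraph k F trees

  r : ℕ
  r = 3 + k

  ΣG : (VG F → ℕ) → ℕ
  ΣG f = sumL f (vertsG F)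

  ΣG-split : ∀ f → ΣG f ≡ sumFin r (f ∘ cyc) + sumFin m (λ i → sumFin (t i) (λ u → f (tv i u)))
  ΣG-split f = trans (sumL-++ (map inj₁ (allFin r)) _ f)
    (cong₂ _+_ (sumL-map inj₁ f (allFin r))
      (trans (sumL-concatMap f (λ i → map (tv i) (allFin (t i))) (allFin m))
             (sumFin-cong m (λ i → sumL-map (tv i) f (allFin (t i))))))

  N : ℕ
  N = ordG F

  order-glued : N ≡ r + sumFin m t
  order-glued = begin
      length (vertsG F)          ≡⟨ sym (trans (sumL-const (vertsG F) 1) (*-identityʳ _)) ⟩
      ΣG (λ _ → 1)               ≡⟨ ΣG-split (λ _ → 1) ⟩
      sumFin r (λ _ → 1) + sumFin m (λ i → sumFin (t i) (λ _ → 1))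
                                 ≡⟨ cong₂ _+_ (count r) (sumFin-cong m (count ∘ t)) ⟩
      r + sumFin m t ∎
    where
    open ≡-Reasoning
    count : ∀ n → sumFin n (λ _ → 1) ≡ n
    count n = trans (sumFin-const n 1) (*-identityʳ n)

  order-tree : ∀ i → order (tree F i) ≡ suc (t i)
  order-tree i = ListP.length-tabulate {n = suc (t i)} (λ z → z)

  degT : (i : Fin m) → Fin (suc (t i)) → ℕ
  degT i = deg (tree F i)

  dY : Fin m → ℕ
  dY i = degT i (y i)

  E : Fin m → ℕ
  E i = sumFin (t i) (degT i ∘ emb i)

  handshake : ∀ i → dY i + E i ≡ t i + t i
  handshake i = trans (sym (sumFin-punchIn (t i) (y i) (degT i))) (Tree.degree-sum i)

  degG : VG F → ℕ
  degG = deg G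

  degG-cycle : ∀ a → degG (cyc a) ≡ 2 + sumFin m (λ i → δ (x i) a * dY i)
  degG-cycle a = trans (ΣG-split (λ v → [ adjG F (cyc a) v ])) (cong₂ _+_ (Cyc.degree-two a) (sumFin-cong m fromTree))
    where
    dY-punched : ∀ i → dY i ≡ sumFin (t i) (λ u → [ tadj i (y i) (emb i u) ])
    dY-punched i = trans (sumFin-punchIn (t i) (y i) (λ v → [ tadj i (y i) v ]))
                         (cong (λ b → [ b ] + sumFin (t i) (λ u → [ tadj i (y i) (emb i u) ])) (IsTree.irreflexive (trees i) (y i)))
    fromTree : ∀ i → sumFin (t i) (λ u → [ isYes (x i Fin.≟ a) ∧ tadj i (y i) (emb i u) ]) ≡ δ (x i) a * dY i
    fromTree i = begin
        sumFin (t i) (λ u → [ isYes (x i Fin.≟ a) ∧ tadj i (y i) (emb i u) ])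
          ≡⟨ sumFin-cong (t i) (λ u → [∧] (isYes (x i Fin.≟ a)) _) ⟩
        sumFin (t i) (λ u → δ (x i) a * [ tadj i (y i) (emb i u) ])
          ≡⟨ sumL-*ˡ (allFin (t i)) (δ (x i) a) _ ⟩
        δ (x i) a * sumFin (t i) (λ u → [ tadj i (y i) (emb i u) ])
          ≡⟨ cong (δ (x i) a *_) (sym (dY-punched i)) ⟩
        δ (x i) a * dY i ∎
      where open ≡-Reasoning

  degG-tree : ∀ i u → degG (tv i u) ≡ degT i (emb i u)
  degG-tree i u = trans (ΣG-split (λ v → [ adjG F (tv i u) v ]))
                        (trans (cong₂ _+_ toCycle toTrees) (sym (sumFin-punchIn (t i) (y i) (λ v → [ tadj i (emb i u) v ]))))
    where
    toCycle : sumFin r (λ b → [ isYes (x i Fin.≟ b) ∧ tadj i (emb i u) (y i) ]) ≡ [ tadj i (emb i u) (y i) ]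
    toCycle = trans (sumFin-cong r (λ b → [∧] (isYes (x i Fin.≟ b)) _)) (sumFin-δ r (x i) (λ _ → [ tadj i (emb i u) (y i) ]))
    toTrees : sumFin m (λ j → sumFin (t j) (λ w → [ adjG F (tv i u) (tv j w) ])) ≡ sumFin (t i) (λ w → [ tadj i (emb i u) (emb i w) ])
    toTrees = trans (sumFin-single m i (λ j → sumFin (t j) (λ w → [ adjG F (tv i u) (tv j w) ])) otherTrees)
                    (sumFin-cong (t i) (λ w → cong [_] (adj-same i u w)))
      where
      otherTrees : ∀ j → j ≢ i → sumFin (t j) (λ w → [ adjG F (tv i u) (tv j w) ]) ≡ 0
      otherTrees j j≢i = sumL-vanish (allFin (t j)) (λ w → cong [_] (adj-other i j u w (j≢i ∘ sym)))

  foot : VG F → Fin r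
  foot (cyc a)  = a
  foot (tv i _) = x i

  fibre : (VG F → ℕ) → Fin r → ℕ
  fibre g a = ΣG (λ v → δ (foot v) a * g v)

  ΣG-by-fibres : ∀ (g : VG F → ℕ) (φ : Fin r → ℕ) → ΣG (λ v → g v * φ (foot v)) ≡ sumFin r (λ a → fibre g a * φ a)
  ΣG-by-fibres g φ = begin
      ΣG (λ v → g v * φ (foot v))
        ≡⟨ sumL-cong (vertsG F) (λ v → cong (g v *_) (sym (sumFin-δ r (foot v) φ))) ⟩
      ΣG (λ v → g v * sumFin r (λ a → δ (foot v) a * φ a))
        ≡⟨ sumL-cong (vertsG F) (λ v → sym (sumL-*ˡ (allFin r) (g v) _)) ⟩
      ΣG (λ v → sumFin r (λ a → g v * (δ (foot v) a * φ a)))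
        ≡⟨ sumL-swap (vertsG F) (allFin r) (λ v a → g v * (δ (foot v) a * φ a)) ⟩
      sumFin r (λ a → ΣG (λ v → g v * (δ (foot v) a * φ a)))
        ≡⟨ sumFin-cong r (λ a → trans (sumL-cong (vertsG F) (λ v → rearrange (g v) (δ (foot v) a) (φ a)))
                                      (sumL-*ʳ (vertsG F) (φ a) (λ v → δ (foot v) a * g v))) ⟩
      sumFin r (λ a → fibre g a * φ a) ∎
    where
    open ≡-Reasoning
    rearrange : ∀ p q s → p * (q * s) ≡ q * p * s
    rearrange = solve-∀

  mult : Fin r → ℕ
  mult a = 1 + sumFin m (λ i → δ (x i) a * t i)

  nVec≡mult : ∀ a → nVec F a ≡ mult a
  nVec≡mult a = begin
      (sumFin m (λ i → if isYes (x i Fin.≟ a) then order (tree F i) else 0) ∸ sumFin m (λ i → if isYes (x i Fin.≟ a) then 1 else 0)) + 1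
        ≡⟨ cong₂ (λ p q → (p ∸ q) + 1) (sumFin-cong m sizes) (sumFin-cong m (λ i → if-then-0 _ 1)) ⟩
      (sumFin m (λ i → δ (x i) a * 1 + δ (x i) a * t i) ∸ sumFin m (λ i → δ (x i) a * 1)) + 1
        ≡⟨ cong (λ p → (p ∸ sumFin m (λ i → δ (x i) a * 1)) + 1) (sumL-+ (allFin m) _ _) ⟩
      (sumFin m (λ i → δ (x i) a * 1) + sumFin m (λ i → δ (x i) a * t i) ∸ sumFin m (λ i → δ (x i) a * 1)) + 1
        ≡⟨ cong (_+ 1) (m+n∸m≡n (sumFin m (λ i → δ (x i) a * 1)) (sumFin m (λ i → δ (x i) a * t i))) ⟩
      sumFin m (λ i → δ (x i) a * t i) + 1
        ≡⟨ +-comm _ 1 ⟩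
      mult a ∎
    where
    open ≡-Reasoning
    sizes : ∀ i → (if isYes (x i Fin.≟ a) then order (tree F i) else 0) ≡ δ (x i) a * 1 + δ (x i) a * t i
    sizes i = trans (if-then-0 (isYes (x i Fin.≟ a)) (order (tree F i))) (trans (cong (δ (x i) a *_) (order-tree i)) (*-distribˡ-+ (δ (x i) a) 1 (t i)))

  fibre-trees : ∀ (g : VG F → ℕ) a → sumFin m (λ i → sumFin (t i) (λ u → δ (x i) a * g (tv i u)))
                                     ≡ sumFin m (λ i → δ (x i) a * sumFin (t i) (g ∘ tv i))
  fibre-trees g a = sumFin-cong m (λ i → sumL-*ˡ (allFin (t i)) (δ (x i) a) (g ∘ tv i))

  fibre-one : ∀ a → fibre (λ _ → 1) a ≡ mult a
  fibre-one a = trans (ΣG-split (λ v → δ (foot v) a * 1)) (cong₂ _+_ (sumFin-δ′ r a (λ _ → 1))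
                  (trans (fibre-trees (λ _ → 1) a) (sumFin-cong m (λ i → cong (δ (x i) a *_) (trans (sumFin-const (t i) 1) (*-identityʳ (t i)))))))

  -- Σ_{v over a} deg v = 2 n_a, by the handshake lemma in each attached tree
  fibre-deg : ∀ a → fibre degG a ≡ 2 * mult a
  fibre-deg a = begin
      fibre degG a
        ≡⟨ ΣG-split (λ v → δ (foot v) a * degG v) ⟩
      sumFin r (λ b → δ b a * degG (cyc b)) + sumFin m (λ i → sumFin (t i) (λ u → δ (x i) a * degG (tv i u)))
        ≡⟨ cong₂ _+_ (trans (sumFin-δ′ r a (degG ∘ cyc)) (degG-cycle a))
                     (trans (fibre-trees degG a) (sumFin-cong m (λ i → cong (δ (x i) a *_) (sumFin-cong (t i) (degG-tree i))))) ⟩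
      2 + sumFin m (λ i → δ (x i) a * dY i) + sumFin m (λ i → δ (x i) a * E i)
        ≡⟨ trans (+-assoc 2 (sumFin m (λ i → δ (x i) a * dY i)) (sumFin m (λ i → δ (x i) a * E i)))
                 (cong (2 +_) (sym (sumL-+ (allFin m) (λ i → δ (x i) a * dY i) (λ i → δ (x i) a * E i)))) ⟩
      2 + sumFin m (λ i → δ (x i) a * dY i + δ (x i) a * E i)
        ≡⟨ cong (2 +_) (sumFin-cong m (λ i → trans (sym (*-distribˡ-+ (δ (x i) a) (dY i) (E i))) (cong (δ (x i) a *_) (handshake i)))) ⟩
      2 + sumFin m (λ i → δ (x i) a * (t i + t i))
        ≡⟨ cong (2 +_) (trans (sumFin-cong m (λ i → double (δ (x i) a) (t i))) (sumL-*ˡ (allFin m) 2 _)) ⟩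
      2 + 2 * sumFin m (λ i → δ (x i) a * t i)
        ≡⟨ sym (*-distribˡ-+ 2 1 _) ⟩
      2 * mult a ∎
    where
    open ≡-Reasoning
    double : ∀ p q → p * (q + q) ≡ 2 * (p * q)
    double = solve-∀

  mult-sum : sumFin r mult ≡ N
  mult-sum = begin
      sumFin r (λ a → 1 + sumFin m (λ i → δ (x i) a * t i))
        ≡⟨ sumL-+ (allFin r) (λ _ → 1) (λ a → sumFin m (λ i → δ (x i) a * t i)) ⟩
      sumFin r (λ _ → 1) + sumFin r (λ a → sumFin m (λ i → δ (x i) a * t i))
        ≡⟨ cong₂ _+_ (trans (sumFin-const r 1) (*-identityʳ r)) (sumL-swap (allFin r) (allFin m) _) ⟩
      r + sumFin m (λ i → sumFin r (λ a → δ (x i) a * t i))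
        ≡⟨ cong (r +_) (sumFin-cong m (λ i → sumFin-δ r (x i) (λ _ → t i))) ⟩
      r + sumFin m t
        ≡⟨ sym order-glued ⟩
      N ∎
    where open ≡-Reasoning

  -- Σ_v deg v = 2 |V|  (G is unicyclic: |E| = |V|)
  degree-sum-glued : ΣG degG ≡ 2 * N
  degree-sum-glued = begin
      ΣG degG                               ≡⟨ sumL-cong (vertsG F) (λ v → sym (*-identityʳ (degG v))) ⟩
      ΣG (λ v → degG v * 1)                 ≡⟨ ΣG-by-fibres degG (λ _ → 1) ⟩
      sumFin r (λ a → fibre degG a * 1)     ≡⟨ sumFin-cong r (λ a → trans (*-identityʳ _) (fibre-deg a)) ⟩
      sumFin r (λ a → 2 * mult a)           ≡⟨ sumL-*ˡ (allFin r) 2 mult ⟩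
      2 * sumFin r mult                     ≡⟨ cong (2 *_) mult-sum ⟩
      2 * N ∎
    where open ≡-Reasoning

  lift : VG F → ℕ
  lift (cyc _)  = 0
  lift (tv i u) = up i u

  sameTree : ((i : Fin m) → Fin (t i) → Fin (t i) → ℕ) → VG F → VG F → ℕ
  sameTree s (tv i u) (tv j w) with i Fin.≟ j
  ... | yes refl = s i u w
  ... | no _     = 0
  sameTree s (cyc _)  _        = 0
  sameTree s (tv _ _) (cyc _)  = 0

  sameTree-same : ∀ s i u w → sameTree s (tv i u) (tv i w) ≡ s i u w
  sameTree-same s i u w with i Fin.≟ i
  ... | yes refl = refl
  ... | no i≢i   = ⊥-elim (i≢i refl)

  sameTree-other : ∀ s i j u w → i ≢ j → sameTree s (tv i u) (tv j w) ≡ 0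
  sameTree-other s i j u w i≢j with i Fin.≟ j
  ... | yes i≡j = ⊥-elim (i≢j i≡j)
  ... | no _    = refl

  sameTree-cyc : ∀ s v b → sameTree s v (cyc b) ≡ 0
  sameTree-cyc s (cyc _)  b = refl
  sameTree-cyc s (tv _ _) b = refl

  -- climbing to the cycle and back overshoots the distance inside one tree
  detour : VG F → VG F → ℕ
  detour = sameTree (λ i u w → up i u + up i w)

  treeDist : VG F → VG F → ℕ
  treeDist = sameTree (λ i u w → dT i (emb i u) (emb i w))

  dG-decomposition : ∀ v u → dG v u + detour v u ≡ lift v + dC (foot v) (foot u) + lift u + treeDist v u
  dG-decomposition (cyc a)  (cyc b)  = trans (+-identityʳ _) (sym (trans (+-identityʳ _) (+-identityʳ _)))
  dG-decomposition (cyc a)  (tv j w) = trans (+-identityʳ _) (trans (cong (dC a (x j) +_) (Tree.dist-sym j (Tree.adj-sym j) (y j) (emb j w))) (sym (+-identityʳ _)))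
  dG-decomposition (tv i u) (cyc b)  = trans (+-identityʳ _) (sym (trans (+-identityʳ _) (+-identityʳ _)))
  dG-decomposition (tv i u) (tv j w) with i Fin.≟ j
  ... | yes refl = trans (rearrange (dT i (emb i u) (emb i w)) (up i u) (up i w))
                         (cong (λ z → up i u + z + up i w + dT i (emb i u) (emb i w)) (sym (Cyc.diagonal (x i))))
    where
    rearrange : ∀ p q s → p + (q + s) ≡ q + 0 + s + p
    rearrange = solve-∀
  ... | no _ = trans (+-identityʳ _) (trans (cong (up i u + dC (x i) (x j) +_) (Tree.dist-sym j (Tree.adj-sym j) (y j) (emb j w))) (sym (+-identityʳ _)))

  -- double sums over vertex pairs (outer sum over the target u, as in the moment)
  ΣΣ : (VG F → VG F → ℕ) → ℕ
  ΣΣ f = ΣG (λ u → ΣG (λ v → f u v))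

  ΣΣ-+ : ∀ f g → ΣΣ (λ u v → f u v + g u v) ≡ ΣΣ f + ΣΣ g
  ΣΣ-+ f g = trans (sumL-cong (vertsG F) (λ u → sumL-+ (vertsG F) (f u) (g u))) (sumL-+ (vertsG F) (λ u → ΣG (f u)) (λ u → ΣG (g u)))

  sameTree-sum : ∀ s → ΣΣ (λ u v → degG v * sameTree s v u)
                     ≡ sumFin m (λ j → sumFin (t j) (λ w → sumFin (t j) (λ u′ → degT j (emb j u′) * s j u′ w)))
  sameTree-sum s = begin
      ΣΣ (λ u v → degG v * sameTree s v u)
        ≡⟨ ΣG-split (λ u → ΣG (λ v → degG v * sameTree s v u)) ⟩
      sumFin r (λ b → ΣG (λ v → degG v * sameTree s v (cyc b))) + toTrees
        ≡⟨ cong (_+ toTrees) overCycle ⟩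
      toTrees
        ≡⟨ sumFin-cong m (λ j → sumFin-cong (t j) (overTree j)) ⟩
      sumFin m (λ j → sumFin (t j) (λ w → sumFin (t j) (λ u′ → degT j (emb j u′) * s j u′ w))) ∎
    where
    open ≡-Reasoning
    toTrees : ℕ
    toTrees = sumFin m (λ j → sumFin (t j) (λ w → ΣG (λ v → degG v * sameTree s v (tv j w))))
    overCycle : sumFin r (λ b → ΣG (λ v → degG v * sameTree s v (cyc b))) ≡ 0
    overCycle = sumL-vanish (allFin r) (λ b → sumL-vanish (vertsG F) (λ v → trans (cong (degG v *_) (sameTree-cyc s v b)) (*-zeroʳ (degG v))))
    overTree : ∀ j w → ΣG (λ v → degG v * sameTree s v (tv j w)) ≡ sumFin (t j) (λ u′ → degT j (emb j u′) * s j u′ w)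
    overTree j w = trans (ΣG-split (λ v → degG v * sameTree s v (tv j w))) (cong₂ _+_ fromCycle fromTrees)
      where
      fromCycle : sumFin r (λ a → degG (cyc a) * 0) ≡ 0
      fromCycle = sumL-vanish (allFin r) (λ a → *-zeroʳ (degG (cyc a)))
      fromTrees : sumFin m (λ i → sumFin (t i) (λ u → degG (tv i u) * sameTree s (tv i u) (tv j w)))
                  ≡ sumFin (t j) (λ u′ → degT j (emb j u′) * s j u′ w)
      fromTrees = trans (sumFin-single m j _ (λ i i≢j → sumL-vanish (allFin (t i)) (λ u → trans (cong (degG (tv i u) *_) (sameTree-other s i j u w i≢j))
                                                                                                       (*-zeroʳ (degG (tv i u))))))
                        (sumFin-cong (t j) (λ u → cong₂ _*_ (degG-tree j u) (sameTree-same s j u w)))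

  A : Fin m → ℕ
  A i = sumFin (t i) (λ u → degT i (emb i u) * up i u)

  H : Fin m → ℕ
  H i = sumFin (t i) (up i)

  P : Fin m → ℕ
  P i = sumFin (t i) (λ w → sumFin (t i) (λ u → degT i (emb i u) * dT i (emb i u) (emb i w)))

  ΣG-deg-lift : ΣG (λ v → degG v * lift v) ≡ sumFin m A
  ΣG-deg-lift = trans (ΣG-split (λ v → degG v * lift v)) (cong₂ _+_ (sumL-vanish (allFin r) (λ a → *-zeroʳ (degG (cyc a))))
                                               (sumFin-cong m (λ i → sumFin-cong (t i) (λ u → cong (_* up i u) (degG-tree i u)))))

  ΣG-lift : ΣG lift ≡ sumFin m H
  ΣG-lift = trans (ΣG-split lift) (cong (_+ sumFin m H) (sumL-zero (allFin r)))

  cycle-part : ΣΣ (λ u v → degG v * dC (foot v) (foot u)) ≡ 2 * nDn F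
  cycle-part = begin
      ΣG (λ u → ΣG (λ v → degG v * dC (foot v) (foot u)))
        ≡⟨ sumL-cong (vertsG F) (λ u → ΣG-by-fibres degG (λ a → dC a (foot u))) ⟩
      ΣG (λ u → φ (foot u))
        ≡⟨ sumL-cong (vertsG F) (λ u → sym (*-identityˡ (φ (foot u)))) ⟩
      ΣG (λ u → 1 * φ (foot u))
        ≡⟨ ΣG-by-fibres (λ _ → 1) φ ⟩
      sumFin r (λ b → fibre (λ _ → 1) b * φ b)
        ≡⟨ sumFin-cong r (λ b → cong₂ _*_ (fibre-one b) (sumFin-cong r (λ a → cong (_* dC a b) (fibre-deg a)))) ⟩
      sumFin r (λ b → mult b * sumFin r (λ a → 2 * mult a * dC a b))
        ≡⟨ sumFin-cong r (λ b → sym (sumL-*ˡ (allFin r) (mult b) (λ a → 2 * mult a * dC a b))) ⟩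
      sumFin r (λ b → sumFin r (λ a → mult b * (2 * mult a * dC a b)))
        ≡⟨ sumL-swap (allFin r) (allFin r) (λ b a → mult b * (2 * mult a * dC a b)) ⟩
      sumFin r (λ a → sumFin r (λ b → mult b * (2 * mult a * dC a b)))
        ≡⟨ sumFin-cong r (λ a → trans (sumFin-cong r (λ b → rearrange (mult b) (mult a) (dC a b)))
                                      (sumL-*ˡ (allFin r) 2 (λ b → mult a * dC a b * mult b))) ⟩
      sumFin r (λ a → 2 * sumFin r (λ b → mult a * dC a b * mult b))
        ≡⟨ sumL-*ˡ (allFin r) 2 (λ a → sumFin r (λ b → mult a * dC a b * mult b)) ⟩
      2 * sumFin r (λ a → sumFin r (λ b → mult a * dC a b * mult b))
        ≡⟨ cong (2 *_) (sumFin-cong r (λ a → sumFin-cong r (λ b → sym (cong₂ (λ p q → p * dC a b * q) (nVec≡mult a) (nVec≡mult b))))) ⟩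
      2 * nDn F ∎
    where
    open ≡-Reasoning
    φ : Fin r → ℕ
    φ b = sumFin r (λ a → fibre degG a * dC a b)
    rearrange : ∀ p q s → p * (2 * q * s) ≡ 2 * (q * s * p)
    rearrange = solve-∀

  degreeDistance+detour : degreeDistance G + ΣΣ (λ u v → degG v * detour v u)
                          ≡ N * sumFin m A + 2 * nDn F + 2 * N * sumFin m H + sumFin m P
  degreeDistance+detour = begin
      ΣΣ (λ u v → degG v * dist G v u) + ΣΣ correction
        ≡⟨ sym (ΣΣ-+ (λ u v → degG v * dist G v u) correction) ⟩
      ΣΣ (λ u v → degG v * dist G v u + correction u v)
        ≡⟨ sumL-cong (vertsG F) (λ u → sumL-cong (vertsG F) (λ v → pointwise v u)) ⟩
      ΣΣ (λ u v → fromSource u v + alongCycle u v + toTarget u v + insideTree u v)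
        ≡⟨ trans (ΣΣ-+ (λ u v → fromSource u v + alongCycle u v + toTarget u v) insideTree)
                 (cong (_+ ΣΣ insideTree) (trans (ΣΣ-+ (λ u v → fromSource u v + alongCycle u v) toTarget)
                                                 (cong (_+ ΣΣ toTarget) (ΣΣ-+ fromSource alongCycle)))) ⟩
      ΣΣ fromSource + ΣΣ alongCycle + ΣΣ toTarget + ΣΣ insideTree
        ≡⟨ cong₂ _+_ (cong₂ _+_ (cong₂ _+_ fromSource-sum cycle-part) toTarget-sum) (sameTree-sum _) ⟩
      N * sumFin m A + 2 * nDn F + 2 * N * sumFin m H + sumFin m P ∎
    where
    open ≡-Reasoning
    correction fromSource alongCycle toTarget insideTree : VG F → VG F → ℕ
    correction u v = degG v * detour v u
    fromSource u v = degG v * lift v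
    alongCycle u v = degG v * dC (foot v) (foot u)
    toTarget   u v = degG v * lift u
    insideTree u v = degG v * treeDist v u
    distribute : ∀ d a b c e → d * (a + b + c + e) ≡ d * a + d * b + d * c + d * e
    distribute = solve-∀
    pointwise : ∀ v u → degG v * dist G v u + correction u v
                      ≡ fromSource u v + alongCycle u v + toTarget u v + insideTree u v
    pointwise v u = begin
        degG v * dist G v u + degG v * detour v u    ≡⟨ cong (λ z → degG v * z + degG v * detour v u) (dist-glued v u) ⟩
        degG v * dG v u + degG v * detour v u        ≡⟨ sym (*-distribˡ-+ (degG v) (dG v u) (detour v u)) ⟩
        degG v * (dG v u + detour v u)               ≡⟨ cong (degG v *_) (dG-decomposition v u) ⟩
        degG v * (lift v + dC (foot v) (foot u) + lift u + treeDist v u)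
                                                     ≡⟨ distribute (degG v) (lift v) (dC (foot v) (foot u)) (lift u) (treeDist v u) ⟩
        fromSource u v + alongCycle u v + toTarget u v + insideTree u v ∎
    fromSource-sum : ΣΣ fromSource ≡ N * sumFin m A
    fromSource-sum = trans (sumL-const (vertsG F) (ΣG (λ v → degG v * lift v))) (cong (N *_) ΣG-deg-lift)
    toTarget-sum : ΣΣ toTarget ≡ 2 * N * sumFin m H
    toTarget-sum = trans (sumL-cong (vertsG F) (λ u → sumL-*ʳ (vertsG F) (lift u) degG))
                         (trans (sumL-*ˡ (vertsG F) (ΣG degG) lift) (cong₂ _*_ degree-sum-glued ΣG-lift))

  detour-sum : ΣΣ (λ u v → degG v * detour v u) ≡ sumFin m (λ i → t i * A i + E i * H i)
  detour-sum = trans (sameTree-sum _) (sumFin-cong m perTree)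
    where
    perTree : ∀ i → sumFin (t i) (λ w → sumFin (t i) (λ u → degT i (emb i u) * (up i u + up i w))) ≡ t i * A i + E i * H i
    perTree i = begin
        sumFin (t i) (λ w → sumFin (t i) (λ u → degT i (emb i u) * (up i u + up i w)))
          ≡⟨ sumFin-cong (t i) (λ w → trans (sumFin-cong (t i) (λ u → *-distribˡ-+ (degT i (emb i u)) _ _)) (sumL-+ (allFin (t i)) _ _)) ⟩
        sumFin (t i) (λ w → A i + sumFin (t i) (λ u → degT i (emb i u) * up i w))
          ≡⟨ sumFin-cong (t i) (λ w → cong (A i +_) (sumL-*ʳ (allFin (t i)) (up i w) _)) ⟩
        sumFin (t i) (λ w → A i + E i * up i w)
          ≡⟨ sumL-+ (allFin (t i)) _ _ ⟩
        sumFin (t i) (λ w → A i) + sumFin (t i) (λ w → E i * up i w)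
          ≡⟨ cong₂ _+_ (sumFin-const (t i) (A i)) (sumL-*ˡ (allFin (t i)) (E i) (up i)) ⟩
        t i * A i + E i * H i ∎
      where open ≡-Reasoning

  tree-degreeDistance : ∀ i → degreeDistance (tree F i) ≡ A i + dY i * H i + P i
  tree-degreeDistance i = begin
      sumFin (suc (t i)) (λ u → sumFin (suc (t i)) (λ v → degT i v * dT i v u))
        ≡⟨ sumFin-punchIn (t i) (y i) _ ⟩
      sumFin (suc (t i)) (λ v → degT i v * dT i v (y i)) + sumFin (t i) (λ w → sumFin (suc (t i)) (λ v → degT i v * dT i v (emb i w)))
        ≡⟨ cong₂ _+_ toRoot (sumFin-cong (t i) toVertex) ⟩
      A i + sumFin (t i) (λ w → dY i * up i w + sumFin (t i) (λ u → degT i (emb i u) * dT i (emb i u) (emb i w)))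
        ≡⟨ cong (A i +_) (trans (sumL-+ (allFin (t i)) _ _) (cong (_+ P i) (sumL-*ˡ (allFin (t i)) (dY i) (up i)))) ⟩
      A i + (dY i * H i + P i)
        ≡⟨ sym (+-assoc (A i) _ _) ⟩
      A i + dY i * H i + P i ∎
    where
    open ≡-Reasoning
    toRoot : sumFin (suc (t i)) (λ v → degT i v * dT i v (y i)) ≡ A i
    toRoot = trans (sumFin-punchIn (t i) (y i) _) (cong (_+ A i) (trans (cong (dY i *_) (Tree.diagonal i (y i))) (*-zeroʳ (dY i))))
    toVertex : ∀ w → sumFin (suc (t i)) (λ v → degT i v * dT i v (emb i w))
                     ≡ dY i * up i w + sumFin (t i) (λ u → degT i (emb i u) * dT i (emb i u) (emb i w))
    toVertex w = trans (sumFin-punchIn (t i) (y i) _)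
                       (cong (λ z → dY i * z + sumFin (t i) (λ u → degT i (emb i u) * dT i (emb i u) (emb i w))) (Tree.dist-sym i (Tree.adj-sym i) (y i) (emb i w)))

  K : Fin m → ℕ
  K i = N ∸ order (tree F i)

  -- K_i + |V_{T_i}| = |V|, since T_i has fewer vertices than G
  complement : ∀ i → K i + suc (t i) ≡ N
  complement i = trans (cong (λ z → (N ∸ z) + suc (t i)) (order-tree i)) (m∸n+n≡m T≤N)
    where
    T≤N : suc (t i) ≤ N
    T≤N = subst (suc (t i) ≤_) (sym order-glued) (+-mono-≤ (s≤s z≤n) (term≤sumL t (MemP.∈-allFin i)))

  tree-ηmoment : ∀ i → momentAt (tree F i) (η F i) (y i) ≡ K i * A i + (2 * K i + 2) * H i
  tree-ηmoment i = begin
      sumFin (suc (t i)) (λ v → η F i v * dT i v (y i))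
        ≡⟨ sumFin-punchIn (t i) (y i) _ ⟩
      η F i (y i) * dT i (y i) (y i) + sumFin (t i) (λ u → η F i (emb i u) * up i u)
        ≡⟨ cong₂ _+_ (trans (cong (η F i (y i) *_) (Tree.diagonal i (y i))) (*-zeroʳ (η F i (y i))))
                     (sumFin-cong (t i) (λ u → expand (K i) (degT i (emb i u)) (up i u))) ⟩
      sumFin (t i) (λ u → K i * (degT i (emb i u) * up i u) + (2 * K i + 2) * up i u)
        ≡⟨ sumL-+ (allFin (t i)) _ _ ⟩
      sumFin (t i) (λ u → K i * (degT i (emb i u) * up i u)) + sumFin (t i) (λ u → (2 * K i + 2) * up i u)
        ≡⟨ cong₂ _+_ (sumL-*ˡ (allFin (t i)) (K i) _) (sumL-*ˡ (allFin (t i)) (2 * K i + 2) (up i)) ⟩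
      K i * A i + (2 * K i + 2) * H i ∎
    where
    open ≡-Reasoning
    expand : ∀ κ d h → (κ * (d + 2) + 2) * h ≡ κ * (d * h) + (2 * κ + 2) * h
    expand = solve-∀

  tree-contribution : ∀ i → degreeDistance (tree F i) + momentAt (tree F i) (η F i) (y i) + (t i * A i + E i * H i)
                            ≡ N * A i + 2 * N * H i + P i
  tree-contribution i = begin
      degreeDistance (tree F i) + momentAt (tree F i) (η F i) (y i) + (t i * A i + E i * H i)
        ≡⟨ cong₂ (λ p q → p + q + (t i * A i + E i * H i)) (tree-degreeDistance i) (tree-ηmoment i) ⟩
      A i + dY i * H i + P i + (K i * A i + (2 * K i + 2) * H i) + (t i * A i + E i * H i)
        ≡⟨ collect (A i) (H i) (P i) (dY i) (E i) (t i) (K i) ⟩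
      (K i + suc (t i)) * A i + (2 * K i + 2) * H i + (dY i + E i) * H i + P i
        ≡⟨ cong (λ z → (K i + suc (t i)) * A i + (2 * K i + 2) * H i + z * H i + P i) (handshake i) ⟩
      (K i + suc (t i)) * A i + (2 * K i + 2) * H i + (t i + t i) * H i + P i
        ≡⟨ regroup (A i) (H i) (P i) (t i) (K i) ⟩
      (K i + suc (t i)) * A i + 2 * (K i + suc (t i)) * H i + P i
        ≡⟨ cong (λ n → n * A i + 2 * n * H i + P i) (complement i) ⟩
      N * A i + 2 * N * H i + P i ∎
    where
    open ≡-Reasoning
    collect : ∀ a h p d e τ κ → a + d * h + p + (κ * a + (2 * κ + 2) * h) + (τ * a + e * h)
                              ≡ (κ + suc τ) * a + (2 * κ + 2) * h + (d + e) * h + p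
    collect = solve-∀
    regroup : ∀ a h p τ κ → (κ + suc τ) * a + (2 * κ + 2) * h + (τ + τ) * h + p ≡ (κ + suc τ) * a + 2 * (κ + suc τ) * h + p
    regroup = solve-∀

  rhs+detour : rhs F + ΣΣ (λ u v → degG v * detour v u) ≡ N * sumFin m A + 2 * nDn F + 2 * N * sumFin m H + sumFin m P
  rhs+detour = begin
      ΣM + Ση + 2 * nDn F + ΣΣ (λ u v → degG v * detour v u)
        ≡⟨ cong (ΣM + Ση + 2 * nDn F +_) detour-sum ⟩
      ΣM + Ση + 2 * nDn F + Σcorr
        ≡⟨ swap ΣM Ση (2 * nDn F) Σcorr ⟩
      ΣM + Ση + Σcorr + 2 * nDn F
        ≡⟨ cong (_+ 2 * nDn F) (trans (cong (_+ Σcorr) (sym (sumL-+ (allFin m) _ _))) (sym (sumL-+ (allFin m) _ _))) ⟩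
      sumFin m (λ i → degreeDistance (tree F i) + momentAt (tree F i) (η F i) (y i) + (t i * A i + E i * H i)) + 2 * nDn F
        ≡⟨ cong (_+ 2 * nDn F) (sumFin-cong m tree-contribution) ⟩
      sumFin m (λ i → N * A i + 2 * N * H i + P i) + 2 * nDn F
        ≡⟨ cong (_+ 2 * nDn F) (trans (sumL-+ (allFin m) _ _) (cong (_+ sumFin m P) (trans (sumL-+ (allFin m) _ _)
              (cong₂ _+_ (sumL-*ˡ (allFin m) N A) (sumL-*ˡ (allFin m) (2 * N) H))))) ⟩
      N * sumFin m A + 2 * N * sumFin m H + sumFin m P + 2 * nDn F
        ≡⟨ swap′ (N * sumFin m A) (2 * N * sumFin m H) (sumFin m P) (2 * nDn F) ⟩
      N * sumFin m A + 2 * nDn F + 2 * N * sumFin m H + sumFin m P ∎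
    where
    open ≡-Reasoning
    ΣM Ση Σcorr : ℕ
    ΣM = sumFin m (λ i → degreeDistance (tree F i))
    Ση = sumFin m (λ i → momentAt (tree F i) (η F i) (y i))
    Σcorr = sumFin m (λ i → t i * A i + E i * H i)
    swap : ∀ a b c d → a + b + c + d ≡ a + b + d + c
    swap = solve-∀
    swap′ : ∀ a b c d → a + b + c + d ≡ a + d + b + c
    swap′ = solve-∀

proposition4p3 : (r : ℕ) → 3 ≤ r → (F : Family r)
    → (∀ i → IsTree (suc (Family.t F i)) (Family.tadj F i))
    → degreeDistance (glued F) ≡ rhs F
proposition4p3 (suc (suc (suc k))) (s≤s (s≤s (s≤s z≤n))) F trees =
  +-cancelʳ-≡ correction (degreeDistance (glued F)) (rhs F) (begin
    degreeDistance (glued F) + correction                          ≡⟨ degreeDistance+detour ⟩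
    N * sumFin m A + 2 * nDn F + 2 * N * sumFin m H + sumFin m P   ≡⟨ sym rhs+detour ⟩
    rhs F + correction                                             ∎)
  where
  open DegreeDistance k F trees
  open Family F using (m)
  open ≡-Reasoning
  correction : ℕ
  correction = ΣΣ (λ u v → degG v * detour v u)
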